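{- Let $n>3$ and consider the directed circulant graph $C_n^+(1,3)$. For $0<l\le n$, the number $PO(n,l)$ of primitive periodic orbits of length $l$ is \[ PO(n,l)=\begin{cases}\frac{n}{l}\left[\binom{l}{(n-l)/2}+\binom{l}{(2n-l)/2}-\binom{l/2}{(2n-l)/4}\right] & \text{if } l<n,\\[1ex] \binom{l}{l/2}-\binom{l/2}{l/4}+1 & \text{if } l=n \text{ and } 3\mid n,\\[1ex] \binom{l}{l/2}-\binom{l/2}{l/4}+2 & \text{if } l=n \text{ and } 3\nmid n.\end{cases} \]
   Context: $C_n^+(1,3)$ is the directed graph with vertex set $\{0,1,\dots,n-1\}$ (identified with $\mathbb{Z}/n\mathbb{Z}$) whose bonds are $(v,v+1 \bmod n)$ and $(v,v+3\bmod n)$ for every vertex $v$. A circuit of length $l\ge1$ is a sequence of vertices $v_0,\dots,v_l$ with $v_l=v_0$ and each $(v_i,v_{i+1})$ a bond. A periodic orbit is an equivalence class of circuits under cyclic rotation; its length is the length of any of its circuits. A periodic orbit is primitive if it is not a shorter periodic orbit repeated several times. Convention: a binomial coefficient $\binom{a}{b}$ is interpreted as $0$ unless $a,b$ are integers with $0\le b\le a$ (in particular it is $0$ whenever an index is not an integer). -}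

module Defs where

open import Data.Nat using (ℕ; zero; suc; _+_; _*_; _<_; NonZero)
open import Data.Nat.DivMod using (_%_; _/_; m%n<n)
open import Data.Nat.Divisibility using (_∣_; _∣?_)
open import Data.Nat.Combinatorics using (_C_)
open import Data.Fin using (Fin; toℕ; fromℕ<)
import Data.Fin as F
open import Data.Fin.Properties using (any?; all?)
open import Data.Vec using (Vec; []; _∷_; lookup)
open import Data.List using (List; []; _∷_; [_]; map; concatMap; filter)
open import Data.List.Relation.Unary.Any using (Any) renaming (any? to anyL?)
open import Data.Product using (Σ; ∃; _×_; _,_)
open import Data.Sum using (_⊎_)
open import Relation.Binary.PropositionalEquality using (_≡_)
open import Relation.Nullary using (Dec; yes; no; ¬_; does)
open import Relation.Nullary.Decidable using (_×-dec_; _⊎-dec_; ¬?)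
open import Relation.Unary using (Decidable)
open import Data.Bool using (if_then_else_)

-- The digraph C_n^+(1,3) on vertex set ℤ/nℤ ≅ Fin n:
-- (u , v) is a bond iff v ≡ u+1 (mod n) or v ≡ u+3 (mod n).
Bond : (n : ℕ) .{{_ : NonZero n}} → Fin n → Fin n → Set
Bond n u v = toℕ v ≡ (toℕ u + 1) % n ⊎ toℕ v ≡ (toℕ u + 3) % n

bond? : (n : ℕ) .{{_ : NonZero n}} → (u v : Fin n) → Dec (Bond n u v)
bond? n u v = (toℕ v Data.Nat.≟ (toℕ u + 1) % n) ⊎-dec (toℕ v Data.Nat.≟ (toℕ u + 3) % n)

-- A closed walk of length l ≥ 1, v_0, …, v_l with v_l = v_0, is encoded by
-- the vector (v_0, …, v_{l-1}); the vertex v_i for arbitrary i is read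
-- cyclically (index i mod l), so that v_l = v_0 automatically.
at : ∀ {n l} .{{_ : NonZero l}} → Vec (Fin n) l → ℕ → Fin n
at {l = l} c i = lookup c (fromℕ< (m%n<n i l))

IsCircuit : (n l : ℕ) .{{_ : NonZero n}} .{{_ : NonZero l}} → Vec (Fin n) l → Set
IsCircuit n l c = (i : Fin l) → Bond n (at c (toℕ i)) (at c (suc (toℕ i)))

isCircuit? : (n l : ℕ) .{{_ : NonZero n}} .{{_ : NonZero l}} → Decidable (IsCircuit n l)
isCircuit? n l c = all? (λ i → bond? n (at c (toℕ i)) (at c (suc (toℕ i))))

Rotation : ∀ {n l} .{{_ : NonZero l}} → Vec (Fin n) l → Vec (Fin n) l → Set
Rotation {l = l} c c' = ∃ λ (r : Fin l) → (i : Fin l) → lookup c' i ≡ at c (toℕ i + toℕ r)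

rotation? : ∀ {n l} .{{_ : NonZero l}} → (c c' : Vec (Fin n) l) → Dec (Rotation c c')
rotation? c c' = any? (λ r → all? (λ i → lookup c' i F.≟ at c (toℕ i + toℕ r)))

-- c is a shorter circuit (its first m vertices, m < l, m ∣ l) repeated l/m ≥ 2 times:
-- v_i = v_{i mod m} for all i.  (d encodes m = suc d.)
IsRepetition : ∀ {n l} .{{_ : NonZero l}} → Vec (Fin n) l → Set
IsRepetition {l = l} c =
  ∃ λ (d : Fin l) → (suc (toℕ d) < l) × (suc (toℕ d) ∣ l)
    × ((i : Fin l) → lookup c i ≡ at c (toℕ i % suc (toℕ d)))

isRepetition? : ∀ {n l} .{{_ : NonZero l}} → Decidable (IsRepetition {n} {l})
isRepetition? {l = l} c = any? (λ d → (suc (toℕ d) Data.Nat.<? l) ×-dec ((suc (toℕ d) ∣? l)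
    ×-dec all? (λ i → lookup c i F.≟ at c (toℕ i % suc (toℕ d)))))

allVecs : (n l : ℕ) → List (Vec (Fin n) l)
allVecs n zero = [ [] ]
allVecs n (suc l) = concatMap (λ x → map (x ∷_) (allVecs n l)) (Data.List.allFin n)

countClasses : ∀ {A : Set} {R : A → A → Set} → ((x y : A) → Dec (R x y)) → List A → ℕ
countClasses R? [] = 0
countClasses R? (x ∷ xs) =
  if does (anyL? (R? x) xs) then countClasses R? xs else suc (countClasses R? xs)

-- PO(n,l): number of primitive periodic orbits of length l, i.e. the number of
-- rotation classes of circuits of length l that are not repetitions of a shorter circuit
-- (primitivity is rotation-invariant, so it is a property of the orbit).
PO : (n l : ℕ) .{{_ : NonZero n}} .{{_ : NonZero l}} → ℕ
PO n l = countClasses rotation?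
  (filter (λ c → ¬? (isRepetition? c)) (filter (isCircuit? n l) (allVecs n l)))

-- Binomial coefficient binom(a/p , b/q), interpreted as 0 unless both
-- a/p and b/q are (nonnegative) integers with b/q ≤ a/p.
binomQ : (a p b q : ℕ) .{{_ : NonZero p}} .{{_ : NonZero q}} → ℕ
binomQ a p b q =
  if does (p ∣? a) then (if does (q ∣? b) then (a / p) C (b / q) else 0) else 0

-- A primitive circuit of length l is fixed by no nontrivial rotation (a fixed one would have a period
-- dividing l), so its rotation class has exactly l elements and l · PO(n,l) is the number of primitive
-- circuits. A circuit is determined by its start vertex and its word of steps +1/+3, and a word closes
-- up iff n divides its total displacement l + 2t, t being the number of +3 steps; as l ≤ n this total is
-- n, 2n or 3n, and the words of total e number binom(l, (e-l)/2). The circuit is a repetition iff the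
-- word has a proper period whose block is already closed. This never happens for total n; for total 2n
-- the block is a half of total n, giving binom(l/2, (2n-l)/4) such words; total 3n forces l = n and the
-- constant word of +3 steps, which is a repetition iff 3 ∣ n.

module Submission where

module CirculantOrbits where

  open import Data.Bool using (true; false; if_then_else_)
  open import Data.Empty using (⊥; ⊥-elim)
  open import Data.Fin as Fin using (Fin; toℕ; fromℕ<)
  open import Data.Fin.Patterns using (0F; 1F)
  open import Data.Fin.Properties using (any?; all?; toℕ-injective; fromℕ<-cong; fromℕ<-toℕ; toℕ-fromℕ<; toℕ<n)
  open import Data.List
    using (List; []; _∷_; _++_; length; filter; map; allFin; concatMap; cartesianProductWith; cartesianProduct)
  open import Data.List.Membership.Propositional using (_∈_; find; lose)
  open import Data.List.Membership.Propositional.Properties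
    using (∈-filter⁻; ∈-filter⁺; ∈-map⁺; ∈-map⁻; ∈-concatMap⁺; ∈-allFin; ∈-cartesianProduct⁺; ∈-cartesianProduct⁻)
  open import Data.List.Membership.Propositional.Properties.WithK using (unique∧set⇒bag)
  open import Data.List.Properties
    using (++-identityʳ; filter-++; filter-accept; filter-reject; filter-all; filter-none; filter-≐; length-filter;
           length-++; length-map; length-tabulate; map-∘; map-id-local)
  open import Data.List.Relation.Binary.BagAndSetEquality using (∼bag⇒↭)
  open import Data.List.Relation.Binary.Permutation.Propositional.Properties using (↭-length)
  open import Data.List.Relation.Unary.All as All using (All)
  open import Data.List.Relation.Unary.AllPairs using ([]; _∷_)
  open import Data.List.Relation.Unary.Any as Any using (Any; here; there) renaming (any? to anyL?)
  open import Data.List.Relation.Unary.Unique.Propositional using (Unique)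
  open import Data.List.Relation.Unary.Unique.Propositional.Properties
    using (map⁻; map⁺; filter⁺; allFin⁺; cartesianProductWith⁺; cartesianProduct⁺)
  open import Data.Nat
    using (ℕ; zero; suc; _+_; _*_; _∸_; _≤_; _<_; _<?_; _≟_; z≤n; s≤s; s≤s⁻¹; NonZero; >-nonZero; ≢-nonZero⁻¹)
  open import Data.Nat.Combinatorics using (_C_; nCn≡1; nCk+nC[k+1]≡[n+1]C[k+1])
  open import Data.Nat.Divisibility
    using (_∣_; _∣?_; divides; ∣-refl; 1∣_; n∣m*n; ∣n⇒∣m*n; *-monoʳ-∣; *-cancelˡ-∣; ∣⇒≤)
  open import Data.Nat.DivMod
    using (_%_; _/_; m≡m%n+[m/n]*n; m%n<n; m%n%n≡m%n; [m+n]%n≡m%n; m<n⇒m%n≡m; %-distribˡ-+; %-remove-+ʳ;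
           m∣n⇒o%n%m≡o%m; n/1≡n; m*n/n≡m; m*n/m*o≡n/o)
  open import Data.Nat.GCD using (gcd; gcd-GCD; gcd[m,n]∣m; gcd[m,n]∣n; gcd[m,n]≢0; module Bézout)
  open import Data.Nat.Properties
    using (+-suc; +-comm; +-assoc; +-identityʳ; +-commutativeSemigroup; +-cancelˡ-≡; +-mono-≤; +-monoʳ-≤;
           *-suc; *-zeroʳ; *-identityˡ; *-comm; *-assoc; *-cancelˡ-≡; *-cancelʳ-≡; *-cancelˡ-≤; *-cancelʳ-≤;
           *-mono-≤; *-monoˡ-≤; *-monoʳ-≤; *-monoʳ-<; *-distribˡ-∸;
           ≤-refl; ≤-trans; ≤-antisym; ≤-reflexive; ≤-<-trans; <-trans; <-irrefl; <-cmp; <⇒≤; <⇒≱;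
           n<1+n; m≤m+n; m<m*n; n≢0⇒n>0; suc-injective; module ≤-Reasoning;
           m∸n≤m; m<n⇒0<n∸m; m+[n∸m]≡n; m∸n+n≡m; m+n∸m≡n; n∸n≡0)
  open import Data.Nat.Tactic.RingSolver using (solve-∀)
  open import Algebra.Properties.CommutativeSemigroup +-commutativeSemigroup
    using (x∙yz≈yx∙z; x∙yz≈xz∙y; xy∙z≈xz∙y; xy∙z≈x∙zy)
  open import Data.Product using (∃; _×_; _,_; proj₁; proj₂; uncurry)
  open import Data.Sum using (_⊎_; inj₁; inj₂; [_,_]′)
  open import Data.Vec using (Vec; []; _∷_; lookup; tabulate)
  open import Data.Vec.Properties using (∷-injective; lookup∘tabulate; tabulate∘lookup; tabulate-cong)
  open import Function.Base using (id; _∘_; case_of_)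
  open import Function.Bundles using (_⇔_; mk⇔; Equivalence)
  open import Relation.Binary.Definitions using (tri<; tri≈; tri>)
  open import Relation.Binary.PropositionalEquality hiding ([_])
  open import Relation.Binary.Structures using (IsEquivalence)
  open import Relation.Nullary using (Dec; yes; no; ¬_; does)
  open import Relation.Nullary.Decidable using (map′; _×-dec_; _⊎-dec_; ¬?; dec-true; dec-false)
  open import Relation.Unary using (Decidable; _⊆_; _≐_)
  open import Relation.Unary.Properties using (∁?)
  open import Defs

  private variable
    A B : Set

  -- Counting in lists

  count : {P : A → Set} → Decidable P → List A → ℕ
  count P? xs = length (filter P? xs)

  module _ {P : A → Set} (P? : Decidable P) where

    count-none : ∀ xs → (∀ x → ¬ P x) → count P? xs ≡ 0
    count-none xs ¬P = cong length (filter-none P? (All.universal ¬P xs))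

    count-+-count-∁ : ∀ xs → count P? xs + count (∁? P?) xs ≡ length xs
    count-+-count-∁ [] = refl
    count-+-count-∁ (x ∷ xs) with P? x
    ... | yes _ = cong suc (count-+-count-∁ xs)
    ... | no _ = trans (+-suc _ _) (cong suc (count-+-count-∁ xs))

  module _ {P Q : A → Set} (P? : Decidable P) (Q? : Decidable Q) where

    count-cong : P ≐ Q → ∀ xs → count P? xs ≡ count Q? xs
    count-cong P≐Q xs = cong length (filter-≐ P? Q? P≐Q xs)

    count-⊎ : (∀ x → P x → ¬ Q x) → ∀ xs →
      count (λ x → P? x ⊎-dec Q? x) xs ≡ count P? xs + count Q? xs
    count-⊎ disjoint [] = refl
    count-⊎ disjoint (x ∷ xs) with P? x | Q? x
    ... | yes p | yes q = ⊥-elim (disjoint x p q)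
    ... | yes _ | no _ = cong suc (count-⊎ disjoint xs)
    ... | no _ | yes _ = trans (cong suc (count-⊎ disjoint xs)) (sym (+-suc _ _))
    ... | no _ | no _ = count-⊎ disjoint xs

    filter-filter-⊆ : Q ⊆ P → ∀ xs → filter Q? (filter P? xs) ≡ filter Q? xs
    filter-filter-⊆ Q⊆P [] = refl
    filter-filter-⊆ Q⊆P (x ∷ xs) with Q? x
    ... | yes q = trans (cong (filter Q?) (filter-accept P? (Q⊆P q)))
                    (trans (filter-accept Q? q) (cong (x ∷_) (filter-filter-⊆ Q⊆P xs)))
    ... | no ¬q = trans (drop-x (P? x)) (filter-filter-⊆ Q⊆P xs)
      where
      drop-x : Dec (P x) → filter Q? (filter P? (x ∷ xs)) ≡ filter Q? (filter P? xs)
      drop-x (yes p) = trans (cong (filter Q?) (filter-accept P? p)) (filter-reject Q? ¬q)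
      drop-x (no ¬p) = cong (filter Q?) (filter-reject P? ¬p)

  count-++ : ∀ {P : A → Set} (P? : Decidable P) xs ys → count P? (xs ++ ys) ≡ count P? xs + count P? ys
  count-++ P? xs ys = trans (cong length (filter-++ P? xs ys)) (length-++ (filter P? xs))

  count-map : ∀ {P : B → Set} (P? : Decidable P) (f : A → B) xs → count P? (map f xs) ≡ count (P? ∘ f) xs
  count-map P? f [] = refl
  count-map P? f (x ∷ xs) with P? (f x)
  ... | yes _ = cong suc (count-map P? f xs)
  ... | no _ = count-map P? f xs

  concatMap-map≡cartesianProductWith : ∀ {C : Set} (f : A → B → C) xs ys →
    concatMap (λ x → map (f x) ys) xs ≡ cartesianProductWith f xs ys
  concatMap-map≡cartesianProductWith f [] ys = refl
  concatMap-map≡cartesianProductWith f (x ∷ xs) ys = cong (map (f x) ys ++_) (concatMap-map≡cartesianProductWith f xs ys)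

  length-cartesianProduct : (xs : List A) (ys : List B) → length (cartesianProduct xs ys) ≡ length xs * length ys
  length-cartesianProduct [] ys = refl
  length-cartesianProduct (x ∷ xs) ys =
    trans (length-++ (map (x ,_) ys)) (cong₂ _+_ (length-map (x ,_) ys) (length-cartesianProduct xs ys))

  length-≡-of-same-members : {xs ys : List A} → Unique xs → Unique ys →
    (∀ {x} → x ∈ xs → x ∈ ys) → (∀ {x} → x ∈ ys → x ∈ xs) → length xs ≡ length ys
  length-≡-of-same-members u v to from = ↭-length (∼bag⇒↭ (unique∧set⇒bag u v (mk⇔ to from)))

  length-≡-of-inverses : {xs : List A} {ys : List B} → Unique xs → Unique ys →
    (f : A → B) (g : B → A) →
    (∀ {x} → x ∈ xs → f x ∈ ys) → (∀ {y} → y ∈ ys → g y ∈ xs) →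
    (∀ {x} → x ∈ xs → g (f x) ≡ x) → (∀ {y} → y ∈ ys → f (g y) ≡ y) →
    length xs ≡ length ys
  length-≡-of-inverses {xs = xs} {ys} u v f g f∈ g∈ gf fg =
    trans (sym (length-map f xs)) (length-≡-of-same-members unique-fxs v to from)
    where
    unique-fxs : Unique (map f xs)
    unique-fxs = map⁻ {f = g} (subst Unique (sym (trans (sym (map-∘ xs)) (map-id-local (All.tabulate gf)))) u)
    to : ∀ {y} → y ∈ map f xs → y ∈ ys
    to y∈ with ∈-map⁻ f y∈
    ... | x , x∈ , refl = f∈ x∈
    from : ∀ {y} → y ∈ ys → y ∈ map f xs
    from y∈ = subst (_∈ map f xs) (fg y∈) (∈-map⁺ f (g∈ y∈))

  module _ {R : A → A → Set} (R? : ∀ x y → Dec (R x y)) (isEquivalence : IsEquivalence R) where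

    open IsEquivalence isEquivalence renaming (refl to R-refl; sym to R-sym; trans to R-trans)

    deleteClass : A → List A → List A
    deleteClass x = filter (∁? (R? x))

    countClasses-∷-related : ∀ {y ys} → Any (R y) ys → countClasses R? (y ∷ ys) ≡ countClasses R? ys
    countClasses-∷-related {y} {ys} y~ys rewrite dec-true (anyL? (R? y) ys) y~ys = refl

    countClasses-∷-fresh : ∀ {y ys} → ¬ Any (R y) ys → countClasses R? (y ∷ ys) ≡ suc (countClasses R? ys)
    countClasses-∷-fresh {y} {ys} y≁ys rewrite dec-false (anyL? (R? y) ys) y≁ys = refl

    countClasses-∷-cong : ∀ y {ys zs} → (Any (R y) ys → Any (R y) zs) → (Any (R y) zs → Any (R y) ys) →
      countClasses R? ys ≡ suc (countClasses R? zs) → countClasses R? (y ∷ ys) ≡ suc (countClasses R? (y ∷ zs))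
    countClasses-∷-cong y {ys} {zs} to from eq = by-cases (anyL? (R? y) ys)
      where
      by-cases : Dec (Any (R y) ys) → countClasses R? (y ∷ ys) ≡ suc (countClasses R? (y ∷ zs))
      by-cases (yes y~ys) = trans (countClasses-∷-related y~ys)
        (trans eq (cong suc (sym (countClasses-∷-related (to y~ys)))))
      by-cases (no y≁ys) = trans (countClasses-∷-fresh y≁ys)
        (cong suc (trans eq (sym (countClasses-∷-fresh (y≁ys ∘ from)))))

    countClasses-deleteClass : ∀ {x} xs → Any (R x) xs →
      countClasses R? xs ≡ suc (countClasses R? (deleteClass x xs))
    countClasses-deleteClass {x} (y ∷ ys) x~ = by-cases (R? x y)
      where
      by-cases : Dec (R x y) → countClasses R? (y ∷ ys) ≡ suc (countClasses R? (deleteClass x (y ∷ ys)))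
      by-cases (yes x~y) = trans (drop-y (anyL? (R? x) ys))
        (cong (suc ∘ countClasses R?) (sym (filter-reject (∁? (R? x)) λ x≁y → x≁y x~y)))
        where
        drop-y : Dec (Any (R x) ys) → countClasses R? (y ∷ ys) ≡ suc (countClasses R? (deleteClass x ys))
        drop-y (yes x~ys) = trans (countClasses-∷-related (Any.map (R-trans (R-sym x~y)) x~ys))
          (countClasses-deleteClass ys x~ys)
        drop-y (no x≁ys) = trans (countClasses-∷-fresh (x≁ys ∘ Any.map (R-trans x~y)))
          (cong (suc ∘ countClasses R?) (sym (filter-all (∁? (R? x))
            (All.tabulate λ z∈ x~z → x≁ys (Any.map (λ { refl → x~z }) z∈)))))
      by-cases (no x≁y) = trans (countClasses-∷-cong y to from (countClasses-deleteClass ys tail))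
        (cong (suc ∘ countClasses R?) (sym (filter-accept (∁? (R? x)) x≁y)))
        where
        tail : Any (R x) ys
        tail = case x~ of λ where
          (here x~y) → ⊥-elim (x≁y x~y)
          (there x~ys) → x~ys
        to : Any (R y) ys → Any (R y) (deleteClass x ys)
        to y~ys with find y~ys
        ... | z , z∈ , y~z = lose (∈-filter⁺ (∁? (R? x)) z∈ λ x~z → x≁y (R-trans x~z (R-sym y~z))) y~z
        from : Any (R y) (deleteClass x ys) → Any (R y) ys
        from y~ with find y~
        ... | z , z∈ , y~z = lose (proj₁ (∈-filter⁻ (∁? (R? x)) {xs = ys} z∈)) y~z

    countClasses-uniform : ∀ k xs → (∀ {x} → x ∈ xs → count (R? x) xs ≡ k) →
      k * countClasses R? xs ≡ length xs
    countClasses-uniform k xs = go (length xs) xs ≤-refl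
      where
      open ≡-Reasoning
      go : ∀ N xs → length xs ≤ N → (∀ {x} → x ∈ xs → count (R? x) xs ≡ k) →
        k * countClasses R? xs ≡ length xs
      go _ [] _ _ = *-zeroʳ k
      go (suc N) (y ∷ ys) (s≤s ys≤N) class-size = begin
        k * countClasses R? (y ∷ ys)         ≡⟨ cong (k *_) (countClasses-deleteClass (y ∷ ys) (here R-refl)) ⟩
        k * suc (countClasses R? rest)       ≡⟨ *-suc k _ ⟩
        k + k * countClasses R? rest         ≡⟨ cong₂ _+_ (sym (class-size (here refl))) (go N rest rest≤N rest-class-size) ⟩
        count (R? y) (y ∷ ys) + length rest  ≡⟨ count-+-count-∁ (R? y) (y ∷ ys) ⟩
        length (y ∷ ys)                      ∎
        where
        rest = deleteClass y (y ∷ ys)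
        rest≤N : length rest ≤ N
        rest≤N rewrite filter-reject (∁? (R? y)) {xs = ys} (λ y≁y → y≁y R-refl) =
          ≤-trans (length-filter (∁? (R? y)) ys) ys≤N
        rest-class-size : ∀ {x} → x ∈ rest → count (R? x) rest ≡ k
        rest-class-size {x} x∈ with ∈-filter⁻ (∁? (R? y)) {xs = y ∷ ys} x∈
        ... | x∈ys , y≁x = trans
          (cong length (filter-filter-⊆ (∁? (R? y)) (R? x) (λ x~z y~z → y≁x (R-trans y~z (R-sym x~z))) (y ∷ ys)))
          (class-size x∈ys)

  -- Cyclic indexing and periods

  lookup-ext : ∀ {k} {u v : Vec A k} → (∀ i → lookup u i ≡ lookup v i) → u ≡ v
  lookup-ext {u = u} {v} eq = trans (sym (tabulate∘lookup u)) (trans (tabulate-cong eq) (tabulate∘lookup v))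

  module _ (l : ℕ) .{{_ : NonZero l}} where

    [m%l+o]%l≡[m+o]%l : ∀ m o → (m % l + o) % l ≡ (m + o) % l
    [m%l+o]%l≡[m+o]%l m o = begin
      (m % l + o) % l        ≡⟨ %-distribˡ-+ (m % l) o l ⟩
      (m % l % l + o % l) % l ≡⟨ cong (λ t → (t + o % l) % l) (m%n%n≡m%n m l) ⟩
      (m % l + o % l) % l    ≡⟨ %-distribˡ-+ m o l ⟨
      (m + o) % l            ∎
      where open ≡-Reasoning

    [m+o%l]%l≡[m+o]%l : ∀ m o → (m + o % l) % l ≡ (m + o) % l
    [m+o%l]%l≡[m+o]%l m o = begin
      (m + o % l) % l ≡⟨ cong (_% l) (+-comm m (o % l)) ⟩
      (o % l + m) % l ≡⟨ [m%l+o]%l≡[m+o]%l o m ⟩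
      (o + m) % l     ≡⟨ cong (_% l) (+-comm o m) ⟩
      (m + o) % l     ∎
      where open ≡-Reasoning

  [m+o]%n≡m%n⇒n∣o : ∀ m o n .{{_ : NonZero n}} → (m + o) % n ≡ m % n → n ∣ o
  [m+o]%n≡m%n⇒n∣o m o n eq = divides ((r + o) / n) (+-cancelˡ-≡ r _ _ (begin
    r + o                         ≡⟨ m≡m%n+[m/n]*n (r + o) n ⟩
    (r + o) % n + (r + o) / n * n ≡⟨ cong (_+ (r + o) / n * n) (trans ([m%l+o]%l≡[m+o]%l n m o) eq) ⟩
    r + (r + o) / n * n           ∎))
    where
    open ≡-Reasoning
    r = m % n

  module _ {n l : ℕ} .{{_ : NonZero l}} where

    at-cong : (c : Vec (Fin n) l) {x y : ℕ} → x % l ≡ y % l → at c x ≡ at c y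
    at-cong c {x} {y} eq = cong (lookup c) (fromℕ<-cong (x % l) (y % l) eq (m%n<n x l) (m%n<n y l))

    at-% : (c : Vec (Fin n) l) (x : ℕ) → at c (x % l) ≡ at c x
    at-% c x = at-cong c (m%n%n≡m%n x l)

    at-+l : (c : Vec (Fin n) l) (x : ℕ) → at c (x + l) ≡ at c x
    at-+l c x = at-cong c ([m+n]%n≡m%n x l)

    lookup≡at : (c : Vec (Fin n) l) (i : Fin l) → lookup c i ≡ at c (toℕ i)
    lookup≡at c i = cong (lookup c) (sym (trans
      (fromℕ<-cong (toℕ i % l) (toℕ i) (m<n⇒m%n≡m (toℕ<n i)) (m%n<n (toℕ i) l) (toℕ<n i))
      (fromℕ<-toℕ i (toℕ<n i))))

    at-tabulate : (f : Fin l → Fin n) (x : ℕ) → at (tabulate f) x ≡ f (fromℕ< (m%n<n x l))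
    at-tabulate f x = lookup∘tabulate f _

    at-tabulate-at : (f : ℕ → Fin n) → (∀ x → f (x % l) ≡ f x) → ∀ x → at (tabulate (f ∘ toℕ)) x ≡ f x
    at-tabulate-at f f-% x = trans (at-tabulate (f ∘ toℕ) x) (trans (cong f (toℕ-fromℕ< (m%n<n x l))) (f-% x))

    Periodic : Vec (Fin n) l → ℕ → Set
    Periodic c m = ∀ x → at c (x + m) ≡ at c x

    Periodic-*-shift : ∀ c {m} → Periodic c m → ∀ k x → at c (x + k * m) ≡ at c x
    Periodic-*-shift c p zero x = cong (at c) (+-identityʳ x)
    Periodic-*-shift c {m} p (suc k) x = begin
      at c (x + (m + k * m)) ≡⟨ cong (at c) (x∙yz≈xz∙y x m (k * m)) ⟩
      at c (x + k * m + m)   ≡⟨ p (x + k * m) ⟩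
      at c (x + k * m)       ≡⟨ Periodic-*-shift c p k x ⟩
      at c x                 ∎
      where open ≡-Reasoning

    Periodic-% : ∀ c {m} .{{_ : NonZero m}} → Periodic c m → ∀ x → at c x ≡ at c (x % m)
    Periodic-% c {m} p x = trans (cong (at c) (m≡m%n+[m/n]*n x m)) (Periodic-*-shift c p (x / m) (x % m))

    Periodic-bézout : ∀ c {a b d} → Periodic c a → Periodic c b → ∀ x y → d + y * b ≡ x * a → Periodic c d
    Periodic-bézout c {a} {b} {d} pa pb x y eq z = begin
      at c (z + d)         ≡⟨ Periodic-*-shift c pb y (z + d) ⟨
      at c (z + d + y * b) ≡⟨ cong (at c) (trans (+-assoc z d (y * b)) (cong (z +_) eq)) ⟩
      at c (z + x * a)     ≡⟨ Periodic-*-shift c pa x z ⟩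
      at c z               ∎
      where open ≡-Reasoning

    Periodic-gcd : ∀ c {a b} → Periodic c a → Periodic c b → Periodic c (gcd a b)
    Periodic-gcd c {a} {b} pa pb with Bézout.identity (gcd-GCD a b)
    ... | Bézout.+- x y eq = Periodic-bézout c pa pb x y eq
    ... | Bézout.-+ x y eq = Periodic-bézout c pb pa y x eq

    periodic? : ∀ c m → Dec (Periodic c m)
    periodic? c m = map′ extend (λ p i → p (toℕ i)) (all? λ i → at c (toℕ i + m) Fin.≟ at c (toℕ i))
      where
      extend : (∀ i → at c (toℕ i + m) ≡ at c (toℕ i)) → Periodic c m
      extend p x = begin
        at c (x + m)       ≡⟨ at-cong c ([m%l+o]%l≡[m+o]%l l x m) ⟨
        at c (x % l + m)   ≡⟨ cong (λ t → at c (t + m)) (toℕ-fromℕ< (m%n<n x l)) ⟨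
        at c (toℕ i + m)   ≡⟨ p i ⟩
        at c (toℕ i)       ≡⟨ cong (at c) (toℕ-fromℕ< (m%n<n x l)) ⟩
        at c (x % l)       ≡⟨ at-% c x ⟩
        at c x             ∎
        where
        open ≡-Reasoning
        i = fromℕ< (m%n<n x l)

    IsRepetition⇒Periodic : ∀ c (rep : IsRepetition c) → Periodic c (suc (toℕ (proj₁ rep)))
    IsRepetition⇒Periodic c (d , _ , m∣l , eq) x = begin
      at c (x + m)       ≡⟨ at≡at-%m (x + m) ⟩
      at c ((x + m) % m) ≡⟨ cong (at c) ([m+n]%n≡m%n x m) ⟩
      at c (x % m)       ≡⟨ at≡at-%m x ⟨
      at c x             ∎
      where
      open ≡-Reasoning
      m = suc (toℕ d)
      at≡at-%m : ∀ y → at c y ≡ at c (y % m)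
      at≡at-%m y = trans (eq (fromℕ< (m%n<n y l)))
        (cong (at c) (trans (cong (_% m) (toℕ-fromℕ< (m%n<n y l))) (m∣n⇒o%n%m≡o%m m l y m∣l)))

    Periodic⇒IsRepetition : ∀ c {m} → 0 < m → m < l → m ∣ l → Periodic c m → IsRepetition c
    Periodic⇒IsRepetition c {suc m} _ m<l m∣l p with fromℕ< (<-trans (n<1+n m) m<l) | toℕ-fromℕ< (<-trans (n<1+n m) m<l)
    ... | d | refl = d , m<l , m∣l , λ i → trans (lookup≡at c i) (Periodic-% c p (toℕ i))

    -- Rotations

    rotate : Vec (Fin n) l → ℕ → Vec (Fin n) l
    rotate c k = tabulate (λ i → at c (toℕ i + k))

    at-rotate : ∀ c k x → at (rotate c k) x ≡ at c (x + k)
    at-rotate c k = at-tabulate-at (λ y → at c (y + k)) (λ y → at-cong c ([m%l+o]%l≡[m+o]%l l y k))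

    rotate-cong : ∀ c {j k} → j % l ≡ k % l → rotate c j ≡ rotate c k
    rotate-cong c {j} {k} eq = tabulate-cong λ i → at-cong c (begin
      (toℕ i + j) % l     ≡⟨ [m+o%l]%l≡[m+o]%l l (toℕ i) j ⟨
      (toℕ i + j % l) % l ≡⟨ cong (λ t → (toℕ i + t) % l) eq ⟩
      (toℕ i + k % l) % l ≡⟨ [m+o%l]%l≡[m+o]%l l (toℕ i) k ⟩
      (toℕ i + k) % l     ∎)
      where open ≡-Reasoning

    rotate-0 : ∀ c → rotate c 0 ≡ c
    rotate-0 c = lookup-ext λ i →
      trans (lookup∘tabulate _ i) (trans (cong (at c) (+-identityʳ (toℕ i))) (sym (lookup≡at c i)))

    rotate-l : ∀ c → rotate c l ≡ c
    rotate-l c = trans (rotate-cong c ([m+n]%n≡m%n 0 l)) (rotate-0 c)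

    rotate-rotate : ∀ c j k → rotate (rotate c j) k ≡ rotate c (k + j)
    rotate-rotate c j k = tabulate-cong λ i → trans (at-rotate c j (toℕ i + k)) (cong (at c) (+-assoc (toℕ i) k j))

    Rotation⇒≡rotate : ∀ c c' (rot : Rotation c c') → c' ≡ rotate c (toℕ (proj₁ rot))
    Rotation⇒≡rotate c c' (r , eq) = lookup-ext λ i → trans (eq i) (sym (lookup∘tabulate _ i))

    Rotation-rotate : ∀ c k → Rotation c (rotate c k)
    Rotation-rotate c k = fromℕ< (m%n<n k l) , λ i → trans (lookup∘tabulate _ i) (at-cong c (begin
      (toℕ i + k) % l                        ≡⟨ [m+o%l]%l≡[m+o]%l l (toℕ i) k ⟨
      (toℕ i + k % l) % l                    ≡⟨ cong (λ t → (toℕ i + t) % l) (toℕ-fromℕ< (m%n<n k l)) ⟨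
      (toℕ i + toℕ (fromℕ< (m%n<n k l))) % l ∎))
      where open ≡-Reasoning

    rotate-rotate-∸ : ∀ c {k} → k ≤ l → rotate (rotate c k) (l ∸ k) ≡ c
    rotate-rotate-∸ c {k} k≤l = begin
      rotate (rotate c k) (l ∸ k) ≡⟨ rotate-rotate c k (l ∸ k) ⟩
      rotate c (l ∸ k + k)        ≡⟨ cong (rotate c) (m∸n+n≡m k≤l) ⟩
      rotate c l                  ≡⟨ rotate-l c ⟩
      c                           ∎
      where open ≡-Reasoning

    Rotation-isEquivalence : IsEquivalence (Rotation {n} {l})
    Rotation-isEquivalence = record
      { refl = λ {c} → subst (Rotation c) (rotate-0 c) (Rotation-rotate c 0)
      ; sym = λ {c} {c'} rot → subst (Rotation c') (rotate-back c c' rot) (Rotation-rotate c' _)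
      ; trans = λ {c} {c'} {c''} rot rot' → subst (Rotation c) (sym (compose c c' c'' rot rot')) (Rotation-rotate c _)
      }
      where
      rotate-back : ∀ c c' (rot : Rotation c c') → rotate c' (l ∸ toℕ (proj₁ rot)) ≡ c
      rotate-back c c' rot@(r , _) = trans (cong (λ v → rotate v (l ∸ toℕ r)) (Rotation⇒≡rotate c c' rot))
        (rotate-rotate-∸ c (<⇒≤ (toℕ<n r)))
      compose : ∀ c c' c'' (rot : Rotation c c') (rot' : Rotation c' c'') →
        c'' ≡ rotate c (toℕ (proj₁ rot') + toℕ (proj₁ rot))
      compose c c' c'' rot rot' = trans (Rotation⇒≡rotate c' c'' rot')
        (trans (cong (λ v → rotate v _) (Rotation⇒≡rotate c c' rot)) (rotate-rotate c _ _))

    Periodic-rotate : ∀ c k {m} → Periodic c m → Periodic (rotate c k) m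
    Periodic-rotate c k {m} p x = begin
      at (rotate c k) (x + m) ≡⟨ at-rotate c k (x + m) ⟩
      at c (x + m + k)        ≡⟨ cong (at c) (xy∙z≈xz∙y x m k) ⟩
      at c (x + k + m)        ≡⟨ p (x + k) ⟩
      at c (x + k)            ≡⟨ at-rotate c k x ⟨
      at (rotate c k) x       ∎
      where open ≡-Reasoning

    IsRepetition-rotate : ∀ c k → IsRepetition c → IsRepetition (rotate c k)
    IsRepetition-rotate c k rep@(_ , m<l , m∣l , _) =
      Periodic⇒IsRepetition (rotate c k) (s≤s z≤n) m<l m∣l (Periodic-rotate c k (IsRepetition⇒Periodic c rep))

    ¬IsRepetition-rotate : ∀ c {k} → k ≤ l → ¬ IsRepetition c → ¬ IsRepetition (rotate c k)
    ¬IsRepetition-rotate c {k} k≤l ¬rep rep =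
      ¬rep (subst IsRepetition (rotate-rotate-∸ c k≤l) (IsRepetition-rotate (rotate c k) (l ∸ k) rep))

    rotate≡rotate⇒IsRepetition : ∀ c {j k} → j < k → k < l → rotate c j ≡ rotate c k → IsRepetition c
    rotate≡rotate⇒IsRepetition c {j} {k} j<k k<l eq =
      Periodic⇒IsRepetition c (n≢0⇒n>0 g≢0) (≤-<-trans g≤t t<l) (gcd[m,n]∣n t l)
        (Periodic-gcd c (λ x → trans (sym (at-rotate c t x)) (cong (λ v → at v x) fixed)) (at-+l c))
      where
      open ≡-Reasoning
      t = k ∸ j
      t<l : t < l
      t<l = ≤-<-trans (m∸n≤m k j) k<l
      g≢0 : gcd t l ≢ 0
      g≢0 = gcd[m,n]≢0 t l (inj₂ (≢-nonZero⁻¹ l))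
      g≤t : gcd t l ≤ t
      g≤t = ∣⇒≤ {{>-nonZero (m<n⇒0<n∸m j<k)}} (gcd[m,n]∣m t l)
      shift : l ∸ j + k ≡ t + l
      shift = begin
        l ∸ j + k         ≡⟨ cong (l ∸ j +_) (m+[n∸m]≡n (<⇒≤ j<k)) ⟨
        l ∸ j + (j + t)   ≡⟨ +-assoc (l ∸ j) j t ⟨
        l ∸ j + j + t     ≡⟨ cong (_+ t) (m∸n+n≡m (<⇒≤ (<-trans j<k k<l))) ⟩
        l + t             ≡⟨ +-comm l t ⟩
        t + l             ∎
      fixed : rotate c t ≡ c
      fixed = begin
        rotate c t                  ≡⟨ rotate-cong c ([m+n]%n≡m%n t l) ⟨
        rotate c (t + l)            ≡⟨ cong (rotate c) shift ⟨
        rotate c (l ∸ j + k)        ≡⟨ rotate-rotate c k (l ∸ j) ⟨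
        rotate (rotate c k) (l ∸ j) ≡⟨ cong (λ v → rotate v (l ∸ j)) eq ⟨
        rotate (rotate c j) (l ∸ j) ≡⟨ rotate-rotate-∸ c (<⇒≤ (<-trans j<k k<l)) ⟩
        c                           ∎

    rotate-injective : ∀ c → ¬ IsRepetition c →
      ∀ {r r' : Fin l} → rotate c (toℕ r) ≡ rotate c (toℕ r') → r ≡ r'
    rotate-injective c ¬rep {r} {r'} eq with <-cmp (toℕ r) (toℕ r')
    ... | tri< r<r' _ _ = ⊥-elim (¬rep (rotate≡rotate⇒IsRepetition c r<r' (toℕ<n r') eq))
    ... | tri≈ _ r≡r' _ = toℕ-injective r≡r'
    ... | tri> _ _ r'<r = ⊥-elim (¬rep (rotate≡rotate⇒IsRepetition c r'<r (toℕ<n r) (sym eq)))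

  -- Primitive circuits and their rotation classes

  allVecs-complete : ∀ n l (v : Vec (Fin n) l) → v ∈ allVecs n l
  allVecs-complete n zero [] = here refl
  allVecs-complete n (suc l) (x ∷ v) =
    ∈-concatMap⁺ (λ y → map (y ∷_) (allVecs n l)) (lose (∈-allFin x) (∈-map⁺ (x ∷_) (allVecs-complete n l v)))

  allVecs-unique : ∀ n l → Unique (allVecs n l)
  allVecs-unique n zero = All.[] ∷ []
  allVecs-unique n (suc l) = subst Unique (sym (concatMap-map≡cartesianProductWith _∷_ (allFin n) (allVecs n l)))
    (cartesianProductWith⁺ _∷_ ∷-injective (allFin⁺ n) (allVecs-unique n l))

  module _ {n l : ℕ} .{{_ : NonZero n}} .{{_ : NonZero l}} where

    IsCircuit⇒Bond : ∀ c → IsCircuit n l c → ∀ x → Bond n (at c x) (at c (1 + x))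
    IsCircuit⇒Bond c circ x = subst₂ (Bond n) (trans (cong (at c) i≡x%l) (at-% c x))
      (trans (cong (λ t → at c (1 + t)) i≡x%l) (at-cong c ([m+o%l]%l≡[m+o]%l l 1 x))) (circ i)
      where
      i = fromℕ< (m%n<n x l)
      i≡x%l : toℕ i ≡ x % l
      i≡x%l = toℕ-fromℕ< (m%n<n x l)

    IsCircuit-rotate : ∀ c → IsCircuit n l c → ∀ k → IsCircuit n l (rotate c k)
    IsCircuit-rotate c circ k i =
      subst₂ (Bond n) (sym (at-rotate c k (toℕ i))) (sym (at-rotate c k (suc (toℕ i)))) (IsCircuit⇒Bond c circ (toℕ i + k))

  module _ (n l : ℕ) .{{_ : NonZero n}} .{{_ : NonZero l}} where

    primitiveCircuits : List (Vec (Fin n) l)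
    primitiveCircuits = filter (λ c → ¬? (isRepetition? c)) (filter (isCircuit? n l) (allVecs n l))

    primitiveCircuits-unique : Unique primitiveCircuits
    primitiveCircuits-unique = filter⁺ _ (filter⁺ _ (allVecs-unique n l))

    ∈-primitiveCircuits⁺ : ∀ {c} → IsCircuit n l c → ¬ IsRepetition c → c ∈ primitiveCircuits
    ∈-primitiveCircuits⁺ {c} circ ¬rep =
      ∈-filter⁺ (λ c → ¬? (isRepetition? c)) (∈-filter⁺ (isCircuit? n l) (allVecs-complete n l c) circ) ¬rep

    ∈-primitiveCircuits⁻ : ∀ {c} → c ∈ primitiveCircuits → IsCircuit n l c × ¬ IsRepetition c
    ∈-primitiveCircuits⁻ c∈ with ∈-filter⁻ (λ c → ¬? (isRepetition? c)) {xs = filter (isCircuit? n l) (allVecs n l)} c∈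
    ... | c∈′ , ¬rep = proj₂ (∈-filter⁻ (isCircuit? n l) {xs = allVecs n l} c∈′) , ¬rep

    orbit-size : ∀ {c} → c ∈ primitiveCircuits → count (rotation? c) primitiveCircuits ≡ l
    orbit-size {c} c∈ = begin
      count (rotation? c) primitiveCircuits   ≡⟨ length-≡-of-same-members (filter⁺ (rotation? c) primitiveCircuits-unique)
                                                   (map⁺ (rotate-injective c ¬rep) (allFin⁺ l)) to from ⟩
      length (map (rotate c ∘ toℕ) (allFin l)) ≡⟨ length-map (rotate c ∘ toℕ) (allFin l) ⟩
      length (allFin l)                        ≡⟨ length-tabulate id ⟩
      l                                        ∎
      where
      open ≡-Reasoning
      circ = proj₁ (∈-primitiveCircuits⁻ c∈)
      ¬rep = proj₂ (∈-primitiveCircuits⁻ c∈)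
      to : ∀ {c'} → c' ∈ filter (rotation? c) primitiveCircuits → c' ∈ map (rotate c ∘ toℕ) (allFin l)
      to {c'} c'∈ with proj₂ (∈-filter⁻ (rotation? c) {xs = primitiveCircuits} c'∈)
      ... | rot = subst (_∈ map (rotate c ∘ toℕ) (allFin l)) (sym (Rotation⇒≡rotate c c' rot))
                    (∈-map⁺ (rotate c ∘ toℕ) (∈-allFin (proj₁ rot)))
      from : ∀ {c'} → c' ∈ map (rotate c ∘ toℕ) (allFin l) → c' ∈ filter (rotation? c) primitiveCircuits
      from c'∈ with ∈-map⁻ (rotate c ∘ toℕ) c'∈
      ... | r , _ , refl = ∈-filter⁺ (rotation? c)
        (∈-primitiveCircuits⁺ (IsCircuit-rotate c circ (toℕ r)) (¬IsRepetition-rotate c (<⇒≤ (toℕ<n r)) ¬rep))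
        (Rotation-rotate c (toℕ r))

    l*PO≡#primitiveCircuits : l * PO n l ≡ length primitiveCircuits
    l*PO≡#primitiveCircuits = countClasses-uniform rotation? Rotation-isEquivalence l primitiveCircuits orbit-size

  -- Step words and their displacement

  partialSum : (ℕ → ℕ) → ℕ → ℕ
  partialSum f zero = 0
  partialSum f (suc k) = partialSum f k + f k

  partialSum-cong : ∀ {f g} → (∀ j → f j ≡ g j) → ∀ k → partialSum f k ≡ partialSum g k
  partialSum-cong f≗g zero = refl
  partialSum-cong f≗g (suc k) = cong₂ _+_ (partialSum-cong f≗g k) (f≗g k)

  partialSum-+ : ∀ f a b → partialSum f (a + b) ≡ partialSum f a + partialSum (λ j → f (a + j)) b
  partialSum-+ f a zero = trans (cong (partialSum f) (+-identityʳ a)) (sym (+-identityʳ _))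
  partialSum-+ f a (suc b) = begin
    partialSum f (a + suc b)                                   ≡⟨ cong (partialSum f) (+-suc a b) ⟩
    partialSum f (a + b) + f (a + b)                           ≡⟨ cong (_+ f (a + b)) (partialSum-+ f a b) ⟩
    partialSum f a + partialSum (λ j → f (a + j)) b + f (a + b) ≡⟨ +-assoc (partialSum f a) _ _ ⟩
    partialSum f a + (partialSum (λ j → f (a + j)) b + f (a + b)) ∎
    where open ≡-Reasoning

  module _ (f : ℕ → ℕ) {m : ℕ} (periodic : ∀ j → f (m + j) ≡ f j) where

    partialSum-periodic-* : ∀ k → partialSum f (k * m) ≡ k * partialSum f m
    partialSum-periodic-* zero = refl
    partialSum-periodic-* (suc k) = begin
      partialSum f (m + k * m)                             ≡⟨ partialSum-+ f m (k * m) ⟩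
      partialSum f m + partialSum (λ j → f (m + j)) (k * m) ≡⟨ cong (partialSum f m +_) (partialSum-cong periodic (k * m)) ⟩
      partialSum f m + partialSum f (k * m)                ≡⟨ cong (partialSum f m +_) (partialSum-periodic-* k) ⟩
      partialSum f m + k * partialSum f m                  ∎
      where open ≡-Reasoning

    partialSum-periodic : ∀ k a → partialSum f (k * m + a) ≡ k * partialSum f m + partialSum f a
    partialSum-periodic k a =
      trans (partialSum-+ f (k * m) a) (cong₂ _+_ (partialSum-periodic-* k) (partialSum-cong (shift k) a))
      where
      shift : ∀ k j → f (k * m + j) ≡ f j
      shift zero j = refl
      shift (suc k) j = trans (cong f (+-assoc m (k * m) j)) (trans (periodic (k * m + j)) (shift k j))

  partialSum-≥ : ∀ f → (∀ j → 1 ≤ f j) → ∀ k → k ≤ partialSum f k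
  partialSum-≥ f 1≤f zero = z≤n
  partialSum-≥ f 1≤f (suc k) = subst (_≤ partialSum f k + f k) (+-comm k 1) (+-mono-≤ (partialSum-≥ f 1≤f k) (1≤f k))

  partialSum-const : ∀ f {c} → (∀ j → f j ≡ c) → ∀ k → partialSum f k ≡ k * c
  partialSum-const f f≡c zero = refl
  partialSum-const f {c} f≡c (suc k) = trans (cong₂ _+_ (partialSum-const f f≡c k) (f≡c k)) (+-comm (k * c) c)

  jump : Fin 2 → ℕ
  jump 0F = 1
  jump 1F = 3

  jump≡1+2*toℕ : ∀ b → jump b ≡ 1 + 2 * toℕ b
  jump≡1+2*toℕ 0F = refl
  jump≡1+2*toℕ 1F = refl

  threes : ∀ {k} → Vec (Fin 2) k → ℕ
  threes [] = 0
  threes (b ∷ w) = toℕ b + threes w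

  threes≤length : ∀ {k} (w : Vec (Fin 2) k) → threes w ≤ k
  threes≤length [] = z≤n
  threes≤length (b ∷ w) = +-mono-≤ (s≤s⁻¹ (toℕ<n b)) (threes≤length w)

  threes≡length⇒all-three : ∀ {k} (w : Vec (Fin 2) k) → threes w ≡ k → ∀ i → lookup w i ≡ 1F
  threes≡length⇒all-three (0F ∷ w) eq i = ⊥-elim (<⇒≱ ≤-refl (subst (_≤ _) eq (threes≤length w)))
  threes≡length⇒all-three (1F ∷ w) eq 0F = refl
  threes≡length⇒all-three (1F ∷ w) eq (Fin.suc i) = threes≡length⇒all-three w (suc-injective eq) i

  partialSum-jump : ∀ {k} (w : Vec (Fin 2) k) f → (∀ j (j<k : j < k) → f j ≡ jump (lookup w (fromℕ< j<k))) →
    partialSum f k ≡ k + 2 * threes w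
  partialSum-jump [] f _ = refl
  partialSum-jump {suc k} (b ∷ w) f f≡jump = begin
    partialSum f (1 + k)                              ≡⟨ partialSum-+ f 1 k ⟩
    f 0 + partialSum (λ j → f (1 + j)) k              ≡⟨ cong₂ _+_ (trans (f≡jump 0 (s≤s z≤n)) (jump≡1+2*toℕ b))
                                                           (partialSum-jump w _ λ j j<k → f≡jump (suc j) (s≤s j<k)) ⟩
    1 + 2 * toℕ b + (k + 2 * threes w)                ≡⟨ rearrange (toℕ b) k (threes w) ⟩
    suc k + 2 * (toℕ b + threes w)                    ∎
    where
    open ≡-Reasoning
    rearrange : ∀ a k t → 1 + 2 * a + (k + 2 * t) ≡ suc k + 2 * (a + t)
    rearrange = solve-∀

  module _ {l : ℕ} .{{_ : NonZero l}} where

    displacement : Vec (Fin 2) l → ℕ → ℕ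
    displacement w = partialSum (jump ∘ at w)

    displacement-length : ∀ w → displacement w l ≡ l + 2 * threes w
    displacement-length w = partialSum-jump w _ λ j j<l →
      cong (jump ∘ lookup w) (fromℕ<-cong (j % l) j (m<n⇒m%n≡m j<l) (m%n<n j l) j<l)

    jump-at-periodic : ∀ w {m} → Periodic w m → ∀ j → jump (at w (m + j)) ≡ jump (at w j)
    jump-at-periodic w {m} p j = cong jump (trans (cong (at w) (+-comm m j)) (p j))

    IsWordRepetition : ℕ → Vec (Fin 2) l → Set
    IsWordRepetition n w = ∃ λ (d : Fin l) → let m = suc (toℕ d) in
      m < l × m ∣ l × Periodic w m × n ∣ displacement w m

    isWordRepetition? : ∀ n w → Dec (IsWordRepetition n w)
    isWordRepetition? n w = any? λ d → let m = suc (toℕ d) in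
      (m <? l) ×-dec (m ∣? l) ×-dec periodic? w m ×-dec (n ∣? displacement w m)

    mkWordRepetition : ∀ {n w m} → 0 < m → m < l → m ∣ l → Periodic w m → n ∣ displacement w m →
      IsWordRepetition n w
    mkWordRepetition {m = suc m} _ m<l with fromℕ< (<-trans (n<1+n m) m<l) | toℕ-fromℕ< (<-trans (n<1+n m) m<l)
    ... | d | refl = λ m∣l p n∣ → d , m<l , m∣l , p , n∣

    IsPrimitiveWord : ℕ → Vec (Fin 2) l → Set
    IsPrimitiveWord n w = n ∣ displacement w l × ¬ IsWordRepetition n w

    isPrimitiveWord? : ∀ n → Decidable (IsPrimitiveWord n)
    isPrimitiveWord? n w = (n ∣? displacement w l) ×-dec ¬? (isWordRepetition? n w)

  primitiveWords : (n l : ℕ) .{{_ : NonZero l}} → List (Vec (Fin 2) l)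
  primitiveWords n l = filter (isPrimitiveWord? n) (allVecs 2 l)

  -- Circuits as start vertex and closed step word

  module Encoding {n l : ℕ} .{{_ : NonZero n}} .{{_ : NonZero l}} (2<n : 2 < n) where

    [u+3]%n≢[u+1]%n : ∀ u → (u + 3) % n ≢ (u + 1) % n
    [u+3]%n≢[u+1]%n u eq = <⇒≱ 2<n (∣⇒≤ ([m+o]%n≡m%n⇒n∣o (u + 1) 2 n (trans (cong (_% n) (+-assoc u 1 2)) eq)))

    stepType : Fin n → Fin n → Fin 2
    stepType u v = if does (toℕ v ≟ (toℕ u + 1) % n) then 0F else 1F

    stepType-jump : ∀ u v b → toℕ v ≡ (toℕ u + jump b) % n → stepType u v ≡ b
    stepType-jump u v 0F eq rewrite dec-true (toℕ v ≟ (toℕ u + 1) % n) eq = refl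
    stepType-jump u v 1F eq
      rewrite dec-false (toℕ v ≟ (toℕ u + 1) % n) (λ eq′ → [u+3]%n≢[u+1]%n (toℕ u) (trans (sym eq) eq′)) = refl

    Bond⇒jump : ∀ {u v} → Bond n u v → ∃ λ b → toℕ v ≡ (toℕ u + jump b) % n
    Bond⇒jump (inj₁ eq) = 0F , eq
    Bond⇒jump (inj₂ eq) = 1F , eq

    jump⇒Bond : ∀ {u v} b → toℕ v ≡ (toℕ u + jump b) % n → Bond n u v
    jump⇒Bond 0F = inj₁
    jump⇒Bond 1F = inj₂

    stepWord : Vec (Fin n) l → Vec (Fin 2) l
    stepWord c = tabulate (λ i → stepType (at c (toℕ i)) (at c (suc (toℕ i))))

    at-stepWord : ∀ c x → at (stepWord c) x ≡ stepType (at c x) (at c (1 + x))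
    at-stepWord c = at-tabulate-at (λ x → stepType (at c x) (at c (suc x)))
      (λ x → cong₂ stepType (at-% c x) (at-cong c ([m+o%l]%l≡[m+o]%l l 1 x)))

    module _ (c : Vec (Fin n) l) (circ : IsCircuit n l c) where

      circuit-step : ∀ x → toℕ (at c (1 + x)) ≡ (toℕ (at c x) + jump (at (stepWord c) x)) % n
      circuit-step x with Bond⇒jump (IsCircuit⇒Bond c circ x)
      ... | b , eq = trans eq (cong (λ t → (toℕ (at c x) + jump t) % n)
                     (sym (trans (at-stepWord c x) (stepType-jump _ _ b eq))))

      circuit-position : ∀ x → toℕ (at c x) ≡ (toℕ (at c 0) + displacement (stepWord c) x) % n
      circuit-position zero = sym (trans (cong (_% n) (+-identityʳ _)) (m<n⇒m%n≡m (toℕ<n (at c 0))))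
      circuit-position (suc x) = begin
        toℕ (at c (1 + x))                ≡⟨ circuit-step x ⟩
        (toℕ (at c x) + j) % n            ≡⟨ cong (λ t → (t + j) % n) (circuit-position x) ⟩
        ((toℕ (at c 0) + d) % n + j) % n  ≡⟨ [m%l+o]%l≡[m+o]%l n _ j ⟩
        (toℕ (at c 0) + d + j) % n        ≡⟨ cong (_% n) (+-assoc _ d j) ⟩
        (toℕ (at c 0) + (d + j)) % n      ∎
        where
        open ≡-Reasoning
        d = displacement (stepWord c) x
        j = jump (at (stepWord c) x)

      Periodic-stepWord : ∀ {m} → Periodic c m → Periodic (stepWord c) m
      Periodic-stepWord {m} p x =
        trans (at-stepWord c (x + m)) (trans (cong₂ stepType (p x) (p (1 + x))) (sym (at-stepWord c x)))

      Periodic⇒n∣displacement : ∀ {m} → Periodic c m → n ∣ displacement (stepWord c) m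
      Periodic⇒n∣displacement {m} p = [m+o]%n≡m%n⇒n∣o (toℕ (at c 0)) _ n
        (trans (sym (circuit-position m)) (trans (cong toℕ (p 0)) (sym (m<n⇒m%n≡m (toℕ<n (at c 0))))))

      Periodic-from-stepWord : ∀ {m} → Periodic (stepWord c) m → n ∣ displacement (stepWord c) m → Periodic c m
      Periodic-from-stepWord {m} pw n∣ x = toℕ-injective (go x)
        where
        go : ∀ x → toℕ (at c (x + m)) ≡ toℕ (at c x)
        go zero = trans (circuit-position m) (trans (%-remove-+ʳ _ n∣) (m<n⇒m%n≡m (toℕ<n (at c 0))))
        go (suc x) = trans (circuit-step (x + m))
          (trans (cong₂ (λ a b → (a + b) % n) (go x) (cong jump (pw x))) (sym (circuit-step x)))

      IsRepetition⇒IsWordRepetition : IsRepetition c → IsWordRepetition n (stepWord c)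
      IsRepetition⇒IsWordRepetition rep@(d , m<l , m∣l , _) =
        d , m<l , m∣l , Periodic-stepWord p , Periodic⇒n∣displacement p
        where p = IsRepetition⇒Periodic c rep

      IsWordRepetition⇒IsRepetition : IsWordRepetition n (stepWord c) → IsRepetition c
      IsWordRepetition⇒IsRepetition (d , m<l , m∣l , p , n∣) =
        Periodic⇒IsRepetition c (s≤s z≤n) m<l m∣l (Periodic-from-stepWord p n∣)

    displacement-% : ∀ w x → displacement w x ≡ x / l * displacement w l + displacement w (x % l)
    displacement-% w x = trans (cong (displacement w) (trans (m≡m%n+[m/n]*n x l) (+-comm (x % l) _)))
      (partialSum-periodic (jump ∘ at w) (jump-at-periodic w (at-+l w)) (x / l) (x % l))

    position : Fin n → Vec (Fin 2) l → ℕ → Fin n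
    position v₀ w x = fromℕ< (m%n<n (toℕ v₀ + displacement w x) n)

    walk : Fin n → Vec (Fin 2) l → Vec (Fin n) l
    walk v₀ w = tabulate (position v₀ w ∘ toℕ)

    walk-stepWord : ∀ c → IsCircuit n l c → walk (at c 0) (stepWord c) ≡ c
    walk-stepWord c circ = lookup-ext λ i → toℕ-injective (begin
      toℕ (lookup (walk (at c 0) (stepWord c)) i)               ≡⟨ cong toℕ (lookup∘tabulate _ i) ⟩
      toℕ (position (at c 0) (stepWord c) (toℕ i))              ≡⟨ toℕ-fromℕ< _ ⟩
      (toℕ (at c 0) + displacement (stepWord c) (toℕ i)) % n    ≡⟨ circuit-position c circ (toℕ i) ⟨
      toℕ (at c (toℕ i))                                        ≡⟨ cong toℕ (lookup≡at c i) ⟨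
      toℕ (lookup c i)                                          ∎)
      where open ≡-Reasoning

    module _ (v₀ : Fin n) (w : Vec (Fin 2) l) (closed : n ∣ displacement w l) where

      toℕ-at-walk : ∀ x → toℕ (at (walk v₀ w) x) ≡ (toℕ v₀ + displacement w x) % n
      toℕ-at-walk x = trans (cong toℕ (at-tabulate-at (position v₀ w) position-% x)) (toℕ-fromℕ< _)
        where
        position-% : ∀ x → position v₀ w (x % l) ≡ position v₀ w x
        position-% x = fromℕ<-cong _ _ (begin
          (toℕ v₀ + displacement w (x % l)) % n                          ≡⟨ %-remove-+ʳ _ (∣n⇒∣m*n (x / l) closed) ⟨
          (toℕ v₀ + displacement w (x % l) + x / l * displacement w l) % n ≡⟨ cong (_% n) (xy∙z≈x∙zy (toℕ v₀) _ _) ⟩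
          (toℕ v₀ + (x / l * displacement w l + displacement w (x % l))) % n ≡⟨ cong (λ t → (toℕ v₀ + t) % n) (displacement-% w x) ⟨
          (toℕ v₀ + displacement w x) % n                                ∎) _ _
          where open ≡-Reasoning

      walk-step : ∀ x → toℕ (at (walk v₀ w) (1 + x)) ≡ (toℕ (at (walk v₀ w) x) + jump (at w x)) % n
      walk-step x = begin
        toℕ (at (walk v₀ w) (1 + x))                  ≡⟨ toℕ-at-walk (1 + x) ⟩
        (toℕ v₀ + (displacement w x + jump (at w x))) % n ≡⟨ cong (_% n) (+-assoc (toℕ v₀) _ _) ⟨
        (toℕ v₀ + displacement w x + jump (at w x)) % n   ≡⟨ [m%l+o]%l≡[m+o]%l n _ _ ⟨
        ((toℕ v₀ + displacement w x) % n + jump (at w x)) % n ≡⟨ cong (λ t → (t + jump (at w x)) % n) (toℕ-at-walk x) ⟨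
        (toℕ (at (walk v₀ w) x) + jump (at w x)) % n  ∎
        where open ≡-Reasoning

      IsCircuit-walk : IsCircuit n l (walk v₀ w)
      IsCircuit-walk i = jump⇒Bond (at w (toℕ i)) (walk-step (toℕ i))

      walk-start : at (walk v₀ w) 0 ≡ v₀
      walk-start = toℕ-injective (trans (toℕ-at-walk 0)
        (trans (cong (_% n) (+-identityʳ (toℕ v₀))) (m<n⇒m%n≡m (toℕ<n v₀))))

      stepWord-walk : stepWord (walk v₀ w) ≡ w
      stepWord-walk = lookup-ext λ i → trans (lookup∘tabulate _ i)
        (trans (stepType-jump _ _ (at w (toℕ i)) (walk-step (toℕ i))) (sym (lookup≡at w i)))

    #primitiveCircuits≡n*#primitiveWords : length (primitiveCircuits n l) ≡ n * length (primitiveWords n l)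
    #primitiveCircuits≡n*#primitiveWords = begin
      length (primitiveCircuits n l)                     ≡⟨ length-≡-of-inverses (primitiveCircuits-unique n l)
                                                              (cartesianProduct⁺ (allFin⁺ n) (filter⁺ (isPrimitiveWord? n) (allVecs-unique 2 l)))
                                                              encode decode encode∈ decode∈ decode∘encode encode∘decode ⟩
      length (cartesianProduct (allFin n) (primitiveWords n l)) ≡⟨ length-cartesianProduct (allFin n) _ ⟩
      length (allFin n) * length (primitiveWords n l)    ≡⟨ cong (_* length (primitiveWords n l)) (length-tabulate {n = n} id) ⟩
      n * length (primitiveWords n l)                    ∎
      where
      open ≡-Reasoning
      encode : Vec (Fin n) l → Fin n × Vec (Fin 2) l
      encode c = at c 0 , stepWord c
      decode : Fin n × Vec (Fin 2) l → Vec (Fin n) l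
      decode (v₀ , w) = walk v₀ w
      primitiveWord⁻ : ∀ {w} → w ∈ primitiveWords n l → IsPrimitiveWord n w
      primitiveWord⁻ w∈ = proj₂ (∈-filter⁻ (isPrimitiveWord? n) {xs = allVecs 2 l} w∈)
      encode∈ : ∀ {c} → c ∈ primitiveCircuits n l → encode c ∈ cartesianProduct (allFin n) (primitiveWords n l)
      encode∈ {c} c∈ with ∈-primitiveCircuits⁻ n l c∈
      ... | circ , ¬rep = ∈-cartesianProduct⁺ (∈-allFin _) (∈-filter⁺ (isPrimitiveWord? n) (allVecs-complete 2 l (stepWord c))
            (Periodic⇒n∣displacement c circ (at-+l c) , ¬rep ∘ IsWordRepetition⇒IsRepetition c circ))
      decode∈ : ∀ {p} → p ∈ cartesianProduct (allFin n) (primitiveWords n l) → decode p ∈ primitiveCircuits n l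
      decode∈ {v₀ , w} p∈ with primitiveWord⁻ (proj₂ (∈-cartesianProduct⁻ (allFin n) _ p∈))
      ... | closed , ¬rep = ∈-primitiveCircuits⁺ n l (IsCircuit-walk v₀ w closed) λ rep →
            ¬rep (subst (IsWordRepetition n) (stepWord-walk v₀ w closed)
              (IsRepetition⇒IsWordRepetition (walk v₀ w) (IsCircuit-walk v₀ w closed) rep))
      decode∘encode : ∀ {c} → c ∈ primitiveCircuits n l → decode (encode c) ≡ c
      decode∘encode {c} c∈ = walk-stepWord c (proj₁ (∈-primitiveCircuits⁻ n l c∈))
      encode∘decode : ∀ {p} → p ∈ cartesianProduct (allFin n) (primitiveWords n l) → encode (decode p) ≡ p
      encode∘decode {v₀ , w} p∈ with primitiveWord⁻ (proj₂ (∈-cartesianProduct⁻ (allFin n) _ p∈))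
      ... | closed , _ = cong₂ _,_ (walk-start v₀ w closed) (stepWord-walk v₀ w closed)

  -- Counting words by their number of +3 steps

  count-allVecs-suc : ∀ k {P : Vec (Fin 2) (suc k) → Set} (P? : Decidable P) →
    count P? (allVecs 2 (suc k)) ≡ count (P? ∘ (0F ∷_)) (allVecs 2 k) + count (P? ∘ (1F ∷_)) (allVecs 2 k)
  count-allVecs-suc k P? = begin
    count P? (map (0F ∷_) ws ++ map (1F ∷_) ws ++ [])           ≡⟨ count-++ P? (map (0F ∷_) ws) _ ⟩
    count P? (map (0F ∷_) ws) + count P? (map (1F ∷_) ws ++ []) ≡⟨ cong (λ t → count P? (map (0F ∷_) ws) + count P? t)
                                                                     (++-identityʳ (map (1F ∷_) ws)) ⟩
    count P? (map (0F ∷_) ws) + count P? (map (1F ∷_) ws)       ≡⟨ cong₂ _+_ (count-map P? (0F ∷_) ws)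
                                                                               (count-map P? (1F ∷_) ws) ⟩
    count (P? ∘ (0F ∷_)) ws + count (P? ∘ (1F ∷_)) ws           ∎
    where
    open ≡-Reasoning
    ws = allVecs 2 k

  threes≟ : ∀ {k} b → Decidable (λ (w : Vec (Fin 2) k) → threes w ≡ b)
  threes≟ b w = threes w ≟ b

  count-threes : ∀ k b → count (threes≟ b) (allVecs 2 k) ≡ k C b
  count-threes zero zero = refl
  count-threes zero (suc b) = refl
  count-threes (suc k) zero = begin
    count (threes≟ 0) (allVecs 2 (suc k))                  ≡⟨ count-allVecs-suc k (threes≟ 0) ⟩
    count (threes≟ 0) ws + count (threes≟ 0 ∘ (1F ∷_)) ws ≡⟨ cong₂ _+_ (count-threes k 0) (count-none _ ws λ _ ()) ⟩
    k C 0 + 0                                              ≡⟨ +-identityʳ (k C 0) ⟩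
    suc k C 0                                              ∎
    where
    open ≡-Reasoning
    ws = allVecs 2 k
  count-threes (suc k) (suc b) = begin
    count (threes≟ (suc b)) (allVecs 2 (suc k))                   ≡⟨ count-allVecs-suc k (threes≟ (suc b)) ⟩
    count (threes≟ (suc b)) ws + count (threes≟ (suc b) ∘ (1F ∷_)) ws
      ≡⟨ cong (count (threes≟ (suc b)) ws +_)
           (count-cong (threes≟ (suc b) ∘ (1F ∷_)) (threes≟ b) (suc-injective , cong suc) ws) ⟩
    count (threes≟ (suc b)) ws + count (threes≟ b) ws             ≡⟨ cong₂ _+_ (count-threes k (suc b)) (count-threes k b) ⟩
    k C suc b + k C b                                             ≡⟨ +-comm (k C suc b) (k C b) ⟩
    k C b + k C suc b                                             ≡⟨ nCk+nC[k+1]≡[n+1]C[k+1] k b ⟩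
    suc k C suc b                                                 ∎
    where
    open ≡-Reasoning
    ws = allVecs 2 k

  module _ (a p b q : ℕ) .{{_ : NonZero p}} .{{_ : NonZero q}} where

    binomQ-∣ : p ∣ a → q ∣ b → binomQ a p b q ≡ (a / p) C (b / q)
    binomQ-∣ p∣a q∣b rewrite dec-true (p ∣? a) p∣a | dec-true (q ∣? b) q∣b = refl

    binomQ-∤ˡ : ¬ p ∣ a → binomQ a p b q ≡ 0
    binomQ-∤ˡ p∤a rewrite dec-false (p ∣? a) p∤a = refl

    binomQ-∤ʳ : ¬ q ∣ b → binomQ a p b q ≡ 0
    binomQ-∤ʳ q∤b rewrite dec-false (q ∣? b) q∤b with does (p ∣? a)
    ... | true = refl
    ... | false = refl

  binomQ-* : ∀ c a p b q .{{_ : NonZero c}} .{{_ : NonZero p}} .{{_ : NonZero q}}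
    .{{_ : NonZero (c * p)}} .{{_ : NonZero (c * q)}} →
    binomQ (c * a) (c * p) (c * b) (c * q) ≡ binomQ a p b q
  binomQ-* c a p b q = by-cases (p ∣? a) (q ∣? b)
    where
    by-cases : Dec (p ∣ a) → Dec (q ∣ b) → binomQ (c * a) (c * p) (c * b) (c * q) ≡ binomQ a p b q
    by-cases (yes p∣a) (yes q∣b) = begin
      binomQ (c * a) (c * p) (c * b) (c * q)        ≡⟨ binomQ-∣ _ _ _ _ (*-monoʳ-∣ c p∣a) (*-monoʳ-∣ c q∣b) ⟩
      (c * a / (c * p)) C (c * b / (c * q))        ≡⟨ cong₂ _C_ (m*n/m*o≡n/o c a p) (m*n/m*o≡n/o c b q) ⟩
      (a / p) C (b / q)                            ≡⟨ binomQ-∣ a p b q p∣a q∣b ⟨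
      binomQ a p b q                               ∎
      where open ≡-Reasoning
    by-cases (no p∤a) _ = trans (binomQ-∤ˡ _ _ _ _ (p∤a ∘ *-cancelˡ-∣ c)) (sym (binomQ-∤ˡ a p b q p∤a))
    by-cases _ (no q∤b) = trans (binomQ-∤ʳ _ _ _ _ (q∤b ∘ *-cancelˡ-∣ c)) (sym (binomQ-∤ʳ a p b q q∤b))

  count-length+2*threes : ∀ k e → k ≤ e → count (λ w → k + 2 * threes w ≟ e) (allVecs 2 k) ≡ binomQ k 1 (e ∸ k) 2
  count-length+2*threes k e k≤e = by-cases (2 ∣? (e ∸ k))
    where
    by-cases : Dec (2 ∣ e ∸ k) → count (λ w → k + 2 * threes w ≟ e) (allVecs 2 k) ≡ binomQ k 1 (e ∸ k) 2
    by-cases (yes 2∣e∸k@(divides t e∸k≡t*2)) = begin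
      count (λ w → k + 2 * threes w ≟ e) (allVecs 2 k) ≡⟨ count-cong (λ w → k + 2 * threes w ≟ e) (threes≟ t) same (allVecs 2 k) ⟩
      count (λ w → threes w ≟ t) (allVecs 2 k)         ≡⟨ count-threes k t ⟩
      k C t                                            ≡⟨ cong₂ _C_ (n/1≡n k) (trans (cong (_/ 2) e∸k≡t*2) (m*n/n≡m t 2)) ⟨
      (k / 1) C ((e ∸ k) / 2)                          ≡⟨ binomQ-∣ k 1 (e ∸ k) 2 (1∣ k) 2∣e∸k ⟨
      binomQ k 1 (e ∸ k) 2                             ∎
      where
      open ≡-Reasoning
      e≡k+2t : e ≡ k + 2 * t
      e≡k+2t = trans (sym (m+[n∸m]≡n k≤e)) (cong (k +_) (trans e∸k≡t*2 (*-comm t 2)))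
      same : (λ (w : Vec (Fin 2) k) → k + 2 * threes w ≡ e) ≐ (λ w → threes w ≡ t)
      same = (λ {w} eq → *-cancelˡ-≡ (threes w) t 2 (+-cancelˡ-≡ k _ _ (trans eq e≡k+2t)))
           , (λ eq → trans (cong (λ s → k + 2 * s) eq) (sym e≡k+2t))
    by-cases (no 2∤e∸k) = trans (count-none _ (allVecs 2 k) λ w eq → 2∤e∸k (divides (threes w)
        (trans (cong (_∸ k) (sym eq)) (trans (m+n∸m≡n k _) (*-comm 2 (threes w))))))
      (sym (binomQ-∤ʳ k 1 (e ∸ k) 2 2∤e∸k))

  count-displacement : ∀ k .{{_ : NonZero k}} e → k ≤ e →
    count (λ (w : Vec (Fin 2) k) → displacement w k ≟ e) (allVecs 2 k) ≡ binomQ k 1 (e ∸ k) 2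
  count-displacement k e k≤e = trans
    (count-cong (λ w → displacement w k ≟ e) (λ w → k + 2 * threes w ≟ e)
      ((λ {w} eq → trans (sym (displacement-length w)) eq) , (λ {w} eq → trans (displacement-length w) eq)) (allVecs 2 k))
    (count-length+2*threes k e k≤e)

  -- Closed words by total displacement

  module Classification {n l : ℕ} .{{_ : NonZero n}} .{{_ : NonZero l}} (l≤n : l ≤ n) where

    m≤displacement : ∀ w m → m ≤ displacement w m
    m≤displacement w = partialSum-≥ (jump ∘ at w) λ j → subst (1 ≤_) (sym (jump≡1+2*toℕ (at w j))) (s≤s z≤n)

    n≤displacement : ∀ w {m} → 0 < m → n ∣ displacement w m → n ≤ displacement w m
    n≤displacement w {m} 0<m = ∣⇒≤ {{>-nonZero (≤-trans 0<m (m≤displacement w m))}}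

    2≤quotient : ∀ {m} q → m < l → l ≡ q * m → 2 ≤ q
    2≤quotient 0 _ l≡0 = ⊥-elim (≢-nonZero⁻¹ l l≡0)
    2≤quotient {m} 1 m<l l≡m = ⊥-elim (<-irrefl (sym (trans l≡m (*-identityˡ m))) m<l)
    2≤quotient (suc (suc _)) _ _ = s≤s (s≤s z≤n)

    displacement-repeat : ∀ w q {m} → Periodic w m → l ≡ q * m → displacement w l ≡ q * displacement w m
    displacement-repeat w q p l≡qm =
      trans (cong (displacement w) l≡qm) (partialSum-periodic-* (jump ∘ at w) (jump-at-periodic w p) q)

    displacement≤3l : ∀ w → displacement w l ≤ 3 * l
    displacement≤3l w = begin
      displacement w l  ≡⟨ displacement-length w ⟩
      l + 2 * threes w  ≤⟨ +-monoʳ-≤ l (*-monoʳ-≤ 2 (threes≤length w)) ⟩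
      3 * l             ∎
      where open ≤-Reasoning

    displacement≡3l⇔threes≡l : ∀ w → displacement w l ≡ 3 * l ⇔ threes w ≡ l
    displacement≡3l⇔threes≡l w = mk⇔
      (λ eq → *-cancelˡ-≡ (threes w) l 2 (+-cancelˡ-≡ l _ _ (trans (sym (displacement-length w)) eq)))
      (λ eq → trans (displacement-length w) (cong (λ t → l + 2 * t) eq))

    displacement≡3l⇒all-three : ∀ w → displacement w l ≡ 3 * l → ∀ x → at w x ≡ 1F
    displacement≡3l⇒all-three w eq x = threes≡length⇒all-three w (Equivalence.to (displacement≡3l⇔threes≡l w) eq) _

    all-three⇒displacement : ∀ w → (∀ x → at w x ≡ 1F) → ∀ m → displacement w m ≡ m * 3
    all-three⇒displacement w all-three = partialSum-const (jump ∘ at w) (cong jump ∘ all-three)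

    displacement-closed-cases : ∀ w → n ∣ displacement w l →
      displacement w l ≡ n ⊎ displacement w l ≡ 2 * n ⊎ displacement w l ≡ 3 * n
    displacement-closed-cases w (divides 0 D≡0) =
      ⊥-elim (<-irrefl (sym D≡0) (≤-trans (n≢0⇒n>0 (≢-nonZero⁻¹ l)) (m≤displacement w l)))
    displacement-closed-cases w (divides 1 D≡n) = inj₁ (trans D≡n (*-identityˡ n))
    displacement-closed-cases w (divides 2 D≡2n) = inj₂ (inj₁ D≡2n)
    displacement-closed-cases w (divides 3 D≡3n) = inj₂ (inj₂ D≡3n)
    displacement-closed-cases w (divides (suc (suc (suc (suc k)))) D≡) = ⊥-elim (<⇒≱ 3n<D (displacement≤3l w))
      where
      3n<D : 3 * l < displacement w l
      3n<D = begin-strict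
        3 * l                         ≤⟨ *-monoʳ-≤ 3 l≤n ⟩
        3 * n                         ≡⟨ *-comm 3 n ⟩
        n * 3                         <⟨ *-monoʳ-< n (s≤s (s≤s (s≤s (s≤s (z≤n {k}))))) ⟩
        n * (4 + k)                   ≡⟨ *-comm n (4 + k) ⟩
        (4 + k) * n                   ≡⟨ D≡ ⟨
        displacement w l              ∎
        where open ≤-Reasoning

    displacement≡n⇒¬IsWordRepetition : ∀ w → displacement w l ≡ n → ¬ IsWordRepetition n w
    displacement≡n⇒¬IsWordRepetition w D≡n (d , m<l , divides q l≡qm , p , n∣) = 2≰1 (*-cancelʳ-≤ 2 1 n (begin
      2 * n                            ≤⟨ *-mono-≤ (2≤quotient q m<l l≡qm) (n≤displacement w (s≤s z≤n) n∣) ⟩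
      q * displacement w (suc (toℕ d)) ≡⟨ displacement-repeat w q p l≡qm ⟨
      displacement w l                 ≡⟨ D≡n ⟩
      n                                ≡⟨ *-identityˡ n ⟨
      1 * n                            ∎))
      where
      open ≤-Reasoning
      2≰1 : ¬ 2 ≤ 1
      2≰1 (s≤s ())

    displacement≡2n⇒half-period : ∀ w → displacement w l ≡ 2 * n → IsWordRepetition n w →
      ∃ λ m → l ≡ 2 * m × Periodic w m × displacement w m ≡ n
    displacement≡2n⇒half-period w D≡2n (d , m<l , divides q l≡qm , p , n∣) = m , l≡2m , p , Dm≡n
      where
      m = suc (toℕ d)
      qDm≡2n : q * displacement w m ≡ 2 * n
      qDm≡2n = trans (sym (displacement-repeat w q p l≡qm)) D≡2n
      Dm≡n : displacement w m ≡ n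
      Dm≡n = ≤-antisym
        (*-cancelˡ-≤ 2 (≤-trans (*-monoˡ-≤ (displacement w m) (2≤quotient q m<l l≡qm)) (≤-reflexive qDm≡2n)))
        (n≤displacement w (s≤s z≤n) n∣)
      l≡2m : l ≡ 2 * m
      l≡2m = trans l≡qm (cong (_* m) (*-cancelʳ-≡ q 2 n (trans (cong (q *_) (sym Dm≡n)) qDm≡2n)))

    displacement≡3n⇒3∣n : l ≡ n → ∀ w → displacement w l ≡ 3 * n → IsWordRepetition n w → 3 ∣ n
    displacement≡3n⇒3∣n l≡n w D≡3n (d , m<l , divides q l≡qm , p , divides k Dm≡kn) =
      divides m (trans (sym l≡n) (trans l≡qm (trans (cong (_* m) q≡3) (*-comm 3 m))))
      where
      open ≡-Reasoning
      m = suc (toℕ d)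
      m*3≡kq*m : m * 3 ≡ k * q * m
      m*3≡kq*m = begin
        m * 3              ≡⟨ all-three⇒displacement w (displacement≡3l⇒all-three w (trans D≡3n (cong (3 *_) (sym l≡n)))) m ⟨
        displacement w m   ≡⟨ Dm≡kn ⟩
        k * n              ≡⟨ cong (k *_) (trans (sym l≡n) l≡qm) ⟩
        k * (q * m)        ≡⟨ *-assoc k q m ⟨
        k * q * m          ∎
      q≡3 : q ≡ 3
      q≡3 = divisor-of-3 k q (sym (*-cancelʳ-≡ 3 (k * q) m (trans (*-comm 3 m) m*3≡kq*m))) (2≤quotient q m<l l≡qm)
        where
        divisor-of-3 : ∀ k q → k * q ≡ 3 → 2 ≤ q → q ≡ 3
        divisor-of-3 1 q kq≡3 _ = trans (sym (*-identityˡ q)) kq≡3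
        divisor-of-3 (suc (suc k)) q kq≡3 2≤q =
          ⊥-elim (<⇒≱ (s≤s ≤-refl) (≤-trans (*-mono-≤ {2} {2 + k} (s≤s (s≤s z≤n)) 2≤q) (≤-reflexive kq≡3)))

    all-three⇒IsWordRepetition : l ≡ n → 3 ∣ n → ∀ w → (∀ x → at w x ≡ 1F) → IsWordRepetition n w
    all-three⇒IsWordRepetition l≡n (divides j n≡j*3) w all-three =
      mkWordRepetition {w = w} 0<j j<l (divides 3 (trans (trans l≡n n≡j*3) (*-comm j 3)))
        (λ x → trans (all-three (x + j)) (sym (all-three x)))
        (divides 1 (trans (all-three⇒displacement w all-three j) (trans (sym n≡j*3) (sym (*-identityˡ n)))))
      where
      0<j : 0 < j
      0<j = n≢0⇒n>0 λ { refl → ≢-nonZero⁻¹ n n≡j*3 }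
      j<l : j < l
      j<l = subst (j <_) (sym (trans l≡n n≡j*3)) (m<m*n j 3 {{>-nonZero 0<j}} (s≤s (s≤s z≤n)))

    halfPeriodic? : Decidable (λ (w : Vec (Fin 2) l) → displacement w l ≡ 2 * n × IsWordRepetition n w)
    halfPeriodic? w = (displacement w l ≟ 2 * n) ×-dec isWordRepetition? n w

    module HalfPeriod (h : ℕ) .{{_ : NonZero h}} (l≡2h : l ≡ 2 * h) where

      h∣l : h ∣ l
      h∣l = divides 2 l≡2h

      h<l : h < l
      h<l = subst (h <_) (trans (*-comm h 2) (sym l≡2h)) (m<m*n h 2 (s≤s (s≤s z≤n)))

      firstHalf : Vec (Fin 2) l → Vec (Fin 2) h
      firstHalf w = tabulate (at w ∘ toℕ)

      double : Vec (Fin 2) h → Vec (Fin 2) l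
      double u = tabulate (at u ∘ toℕ)

      at-double : ∀ u x → at (double u) x ≡ at u x
      at-double u = at-tabulate-at (at u) λ x → at-cong u (m∣n⇒o%n%m≡o%m h l x h∣l)

      at-firstHalf : ∀ (w : Vec (Fin 2) l) → Periodic w h → ∀ x → at (firstHalf w) x ≡ at w x
      at-firstHalf w p = at-tabulate-at (at w) λ x → sym (Periodic-% w p x)

      Periodic-double : ∀ u → Periodic (double u) h
      Periodic-double u x = trans (at-double u (x + h)) (trans (at-+l u x) (sym (at-double u x)))

      displacement-double : ∀ u m → displacement (double u) m ≡ displacement u m
      displacement-double u = partialSum-cong (cong jump ∘ at-double u)

      displacement-firstHalf : ∀ (w : Vec (Fin 2) l) → Periodic w h →
        ∀ m → displacement (firstHalf w) m ≡ displacement w m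
      displacement-firstHalf w p = partialSum-cong (cong jump ∘ at-firstHalf w p)

      halfClosed? : Decidable (λ (u : Vec (Fin 2) h) → displacement u h ≡ n)
      halfClosed? u = displacement u h ≟ n

      half-period : ∀ (w : Vec (Fin 2) l) → displacement w l ≡ 2 * n → IsWordRepetition n w →
        Periodic w h × displacement w h ≡ n
      half-period w D≡2n rep with displacement≡2n⇒half-period w D≡2n rep
      ... | m , l≡2m , p , Dm≡n with *-cancelˡ-≡ m h 2 (trans (sym l≡2m) l≡2h)
      ... | refl = p , Dm≡n

      #halfPeriodic≡#halfClosed : count halfPeriodic? (allVecs 2 l) ≡ count halfClosed? (allVecs 2 h)
      #halfPeriodic≡#halfClosed = length-≡-of-inverses (filter⁺ halfPeriodic? (allVecs-unique 2 l))
        (filter⁺ halfClosed? (allVecs-unique 2 h)) firstHalf double firstHalf∈ double∈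
        (λ {w} w∈ → double∘firstHalf (uncurry (half-period w) (∈-filter⁻′ halfPeriodic? w∈)))
        (λ _ → firstHalf∘double)
        where
        ∈-filter⁻′ : ∀ {k} {P : Vec (Fin 2) k → Set} (P? : Decidable P) {w} → w ∈ filter P? (allVecs 2 k) → P w
        ∈-filter⁻′ P? {w} w∈ = proj₂ (∈-filter⁻ P? {xs = allVecs 2 _} w∈)
        firstHalf∈ : ∀ {w} → w ∈ filter halfPeriodic? (allVecs 2 l) → firstHalf w ∈ filter halfClosed? (allVecs 2 h)
        firstHalf∈ {w} w∈ with uncurry (half-period w) (∈-filter⁻′ halfPeriodic? w∈)
        ... | p , Dh≡n = ∈-filter⁺ halfClosed? (allVecs-complete 2 h _) (trans (displacement-firstHalf w p h) Dh≡n)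
        double∈ : ∀ {u} → u ∈ filter halfClosed? (allVecs 2 h) → double u ∈ filter halfPeriodic? (allVecs 2 l)
        double∈ {u} u∈ = ∈-filter⁺ halfPeriodic? (allVecs-complete 2 l _) (Dl≡2n , rep)
          where
          Dh≡n : displacement (double u) h ≡ n
          Dh≡n = trans (displacement-double u h) (∈-filter⁻′ halfClosed? u∈)
          Dl≡2n : displacement (double u) l ≡ 2 * n
          Dl≡2n = trans (displacement-repeat (double u) 2 (Periodic-double u) l≡2h) (cong (2 *_) Dh≡n)
          rep : IsWordRepetition n (double u)
          rep = mkWordRepetition {w = double u} (n≢0⇒n>0 (≢-nonZero⁻¹ h)) h<l h∣l (Periodic-double u)
            (divides 1 (trans Dh≡n (sym (*-identityˡ n))))
        double∘firstHalf : ∀ {w : Vec (Fin 2) l} → Periodic w h × displacement w h ≡ n → double (firstHalf w) ≡ w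
        double∘firstHalf {w} (p , _) = lookup-ext λ i →
          trans (lookup∘tabulate _ i) (trans (at-firstHalf w p (toℕ i)) (sym (lookup≡at w i)))
        firstHalf∘double : ∀ {u} → firstHalf (double u) ≡ u
        firstHalf∘double {u} = lookup-ext λ i →
          trans (lookup∘tabulate _ i) (trans (at-double u (toℕ i)) (sym (lookup≡at u i)))

    #halfPeriodic : count halfPeriodic? (allVecs 2 l) ≡ binomQ l 2 (2 * n ∸ l) 4
    #halfPeriodic = by-cases (2 ∣? l)
      where
      by-cases : Dec (2 ∣ l) → count halfPeriodic? (allVecs 2 l) ≡ binomQ l 2 (2 * n ∸ l) 4
      by-cases (yes (divides h l≡h*2)) = begin
        count halfPeriodic? (allVecs 2 l)                        ≡⟨ #halfPeriodic≡#halfClosed ⟩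
        count halfClosed? (allVecs 2 h)                          ≡⟨ count-displacement h n h≤n ⟩
        binomQ h 1 (n ∸ h) 2                                     ≡⟨ binomQ-* 2 h 1 (n ∸ h) 2 ⟨
        binomQ (2 * h) (2 * 1) (2 * (n ∸ h)) (2 * 2)             ≡⟨ cong₂ (λ a b → binomQ a 2 b 4) (sym l≡2h)
                                                                     (trans (*-distribˡ-∸ 2 n h) (cong (2 * n ∸_) (sym l≡2h))) ⟩
        binomQ l 2 (2 * n ∸ l) 4                                 ∎
        where
        open ≡-Reasoning
        l≡2h = trans l≡h*2 (*-comm h 2)
        instance
          _ : NonZero h
          _ = >-nonZero (n≢0⇒n>0 λ { refl → ≢-nonZero⁻¹ l l≡h*2 })
        open HalfPeriod h l≡2h
        h≤n : h ≤ n
        h≤n = ≤-trans (<⇒≤ h<l) l≤n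
      by-cases (no 2∤l) = trans (count-none halfPeriodic? (allVecs 2 l) λ w (D≡2n , rep) → 2∤l (even w D≡2n rep))
        (sym (binomQ-∤ˡ l 2 (2 * n ∸ l) 4 2∤l))
        where
        even : ∀ w → displacement w l ≡ 2 * n → IsWordRepetition n w → 2 ∣ l
        even w D≡2n rep with displacement≡2n⇒half-period w D≡2n rep
        ... | m , l≡2m , _ = divides m (trans l≡2m (*-comm 2 m))

    PrimitiveAt : ℕ → Vec (Fin 2) l → Set
    PrimitiveAt e w = displacement w l ≡ e × ¬ IsWordRepetition n w

    displacement≟ : ∀ e → Decidable (λ (w : Vec (Fin 2) l) → displacement w l ≡ e)
    displacement≟ e w = displacement w l ≟ e

    primitiveAt? : ∀ e → Decidable (PrimitiveAt e)
    primitiveAt? e w = displacement≟ e w ×-dec ¬? (isWordRepetition? n w)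

    IsPrimitiveWord≐ : IsPrimitiveWord n ≐ (λ w → displacement w l ≡ n ⊎ PrimitiveAt (2 * n) w ⊎ PrimitiveAt (3 * n) w)
    IsPrimitiveWord≐ = (λ {w} → to w) , (λ {w} → from w)
      where
      to : ∀ w → IsPrimitiveWord n w → displacement w l ≡ n ⊎ PrimitiveAt (2 * n) w ⊎ PrimitiveAt (3 * n) w
      to w (n∣D , ¬rep) with displacement-closed-cases w n∣D
      ... | inj₁ D≡n = inj₁ D≡n
      ... | inj₂ (inj₁ D≡2n) = inj₂ (inj₁ (D≡2n , ¬rep))
      ... | inj₂ (inj₂ D≡3n) = inj₂ (inj₂ (D≡3n , ¬rep))
      from : ∀ w → displacement w l ≡ n ⊎ PrimitiveAt (2 * n) w ⊎ PrimitiveAt (3 * n) w → IsPrimitiveWord n w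
      from w (inj₁ D≡n) = subst (n ∣_) (sym D≡n) ∣-refl , displacement≡n⇒¬IsWordRepetition w D≡n
      from w (inj₂ (inj₁ (D≡2n , ¬rep))) = subst (n ∣_) (sym D≡2n) (n∣m*n 2) , ¬rep
      from w (inj₂ (inj₂ (D≡3n , ¬rep))) = subst (n ∣_) (sym D≡3n) (n∣m*n 3) , ¬rep

    distinct-multiples : ∀ {a b x} → a ≢ b → x ≡ a * n → x ≡ b * n → ⊥
    distinct-multiples a≢b x≡an x≡bn = a≢b (*-cancelʳ-≡ _ _ n (trans (sym x≡an) x≡bn))

    #primitiveWords≡ : length (primitiveWords n l) ≡
      count (displacement≟ n) (allVecs 2 l)
        + (count (primitiveAt? (2 * n)) (allVecs 2 l) + count (primitiveAt? (3 * n)) (allVecs 2 l))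
    #primitiveWords≡ = begin
      count (isPrimitiveWord? n) ws
        ≡⟨ count-cong (isPrimitiveWord? n) (λ w → displacement≟ n w ⊎-dec (primitiveAt? (2 * n) w ⊎-dec primitiveAt? (3 * n) w))
             IsPrimitiveWord≐ ws ⟩
      count (λ w → displacement≟ n w ⊎-dec (primitiveAt? (2 * n) w ⊎-dec primitiveAt? (3 * n) w)) ws
        ≡⟨ count-⊎ (displacement≟ n) _ n-disjoint ws ⟩
      count (displacement≟ n) ws + count (λ w → primitiveAt? (2 * n) w ⊎-dec primitiveAt? (3 * n) w) ws
        ≡⟨ cong (count (displacement≟ n) ws +_) (count-⊎ (primitiveAt? (2 * n)) (primitiveAt? (3 * n)) 2n-3n-disjoint ws) ⟩
      count (displacement≟ n) ws + (count (primitiveAt? (2 * n)) ws + count (primitiveAt? (3 * n)) ws) ∎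
      where
      open ≡-Reasoning
      ws = allVecs 2 l
      n-disjoint : ∀ w → displacement w l ≡ n → ¬ (PrimitiveAt (2 * n) w ⊎ PrimitiveAt (3 * n) w)
      n-disjoint w D≡n (inj₁ (D≡2n , _)) = distinct-multiples {1} {2} (λ ()) (trans D≡n (sym (*-identityˡ n))) D≡2n
      n-disjoint w D≡n (inj₂ (D≡3n , _)) = distinct-multiples {1} {3} (λ ()) (trans D≡n (sym (*-identityˡ n))) D≡3n
      2n-3n-disjoint : ∀ w → PrimitiveAt (2 * n) w → ¬ PrimitiveAt (3 * n) w
      2n-3n-disjoint w (D≡2n , _) (D≡3n , _) = distinct-multiples {2} {3} (λ ()) D≡2n D≡3n

    #displacement≡2n : count (displacement≟ (2 * n)) (allVecs 2 l) ≡
      count halfPeriodic? (allVecs 2 l) + count (primitiveAt? (2 * n)) (allVecs 2 l)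
    #displacement≡2n = trans
      (count-cong (displacement≟ (2 * n)) (λ w → halfPeriodic? w ⊎-dec primitiveAt? (2 * n) w)
        ((λ {w} → split w) , [ proj₁ , proj₁ ]′) (allVecs 2 l))
      (count-⊎ halfPeriodic? (primitiveAt? (2 * n)) disjoint (allVecs 2 l))
      where
      disjoint : ∀ w → displacement w l ≡ 2 * n × IsWordRepetition n w → ¬ PrimitiveAt (2 * n) w
      disjoint w (_ , rep) (_ , ¬rep) = ¬rep rep
      split : ∀ w → displacement w l ≡ 2 * n → displacement w l ≡ 2 * n × IsWordRepetition n w ⊎ PrimitiveAt (2 * n) w
      split w D≡2n with isWordRepetition? n w
      ... | yes rep = inj₁ (D≡2n , rep)
      ... | no ¬rep = inj₂ (D≡2n , ¬rep)

    #primitiveAt3n-< : l < n → count (primitiveAt? (3 * n)) (allVecs 2 l) ≡ 0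
    #primitiveAt3n-< l<n = count-none (primitiveAt? (3 * n)) (allVecs 2 l) λ w (D≡3n , _) →
      <⇒≱ (*-monoʳ-< 3 l<n) (subst (_≤ 3 * l) D≡3n (displacement≤3l w))

    #primitiveAt3n-∣ : l ≡ n → 3 ∣ n → count (primitiveAt? (3 * n)) (allVecs 2 l) ≡ 0
    #primitiveAt3n-∣ l≡n 3∣n = count-none (primitiveAt? (3 * n)) (allVecs 2 l) λ w (D≡3n , ¬rep) →
      ¬rep (all-three⇒IsWordRepetition l≡n 3∣n w (displacement≡3l⇒all-three w (trans D≡3n (cong (3 *_) (sym l≡n)))))

    #primitiveAt3n-∤ : l ≡ n → ¬ 3 ∣ n → count (primitiveAt? (3 * n)) (allVecs 2 l) ≡ 1
    #primitiveAt3n-∤ l≡n 3∤n = begin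
      count (primitiveAt? (3 * n)) (allVecs 2 l) ≡⟨ count-cong (primitiveAt? (3 * n)) (λ w → threes w ≟ l)
                                                      ((λ {w} → to w) , (λ {w} → from w)) (allVecs 2 l) ⟩
      count (λ w → threes w ≟ l) (allVecs 2 l)   ≡⟨ count-threes l l ⟩
      l C l                                      ≡⟨ nCn≡1 l ⟩
      1                                          ∎
      where
      open ≡-Reasoning
      D≡3n⇔D≡3l : ∀ w → displacement w l ≡ 3 * n ⇔ displacement w l ≡ 3 * l
      D≡3n⇔D≡3l w = mk⇔ (λ eq → trans eq (cong (3 *_) (sym l≡n))) (λ eq → trans eq (cong (3 *_) l≡n))
      to : ∀ w → PrimitiveAt (3 * n) w → threes w ≡ l
      to w (D≡3n , _) = Equivalence.to (displacement≡3l⇔threes≡l w) (Equivalence.to (D≡3n⇔D≡3l w) D≡3n)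
      from : ∀ w → threes w ≡ l → PrimitiveAt (3 * n) w
      from w threes≡l = D≡3n , 3∤n ∘ displacement≡3n⇒3∣n l≡n w D≡3n
        where
        D≡3n = Equivalence.from (D≡3n⇔D≡3l w) (Equivalence.from (displacement≡3l⇔threes≡l w) threes≡l)

    #primitiveWords+#halfPeriodic : length (primitiveWords n l) + binomQ l 2 (2 * n ∸ l) 4
      ≡ binomQ l 1 (n ∸ l) 2 + binomQ l 1 (2 * n ∸ l) 2 + count (primitiveAt? (3 * n)) (allVecs 2 l)
    #primitiveWords+#halfPeriodic = begin
      length (primitiveWords n l) + binomQ l 2 (2 * n ∸ l) 4 ≡⟨ cong₂ _+_ #primitiveWords≡ (sym #halfPeriodic) ⟩
      #n + (#2n-primitive + #3n-primitive) + #half    ≡⟨ rearrange #n #2n-primitive #3n-primitive #half ⟩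
      #n + (#half + #2n-primitive) + #3n-primitive    ≡⟨ cong (λ t → #n + t + #3n-primitive) (sym #displacement≡2n) ⟩
      #n + count (displacement≟ (2 * n)) ws + #3n-primitive
        ≡⟨ cong (_+ #3n-primitive) (cong₂ _+_ (count-displacement l n l≤n)
                                               (count-displacement l (2 * n) (≤-trans l≤n (m≤m+n n _)))) ⟩
      binomQ l 1 (n ∸ l) 2 + binomQ l 1 (2 * n ∸ l) 2 + #3n-primitive ∎
      where
      open ≡-Reasoning
      ws = allVecs 2 l
      #n = count (displacement≟ n) ws
      #half = count halfPeriodic? ws
      #2n-primitive = count (primitiveAt? (2 * n)) ws
      #3n-primitive = count (primitiveAt? (3 * n)) ws
      rearrange : ∀ a b c d → a + (b + c) + d ≡ a + (d + b) + c
      rearrange = solve-∀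

    #primitiveWords-l<n : l < n →
      length (primitiveWords n l) + binomQ l 2 (2 * n ∸ l) 4 ≡ binomQ l 1 (n ∸ l) 2 + binomQ l 1 (2 * n ∸ l) 2
    #primitiveWords-l<n l<n = trans #primitiveWords+#halfPeriodic
      (trans (cong (binomQ l 1 (n ∸ l) 2 + binomQ l 1 (2 * n ∸ l) 2 +_) (#primitiveAt3n-< l<n)) (+-identityʳ _))

    #primitiveWords-l≡n : l ≡ n → ∀ {k} → count (primitiveAt? (3 * n)) (allVecs 2 l) ≡ k →
      length (primitiveWords n l) + binomQ l 2 l 4 ≡ binomQ l 1 l 2 + (1 + k)
    #primitiveWords-l≡n l≡n {k} #primitiveAt3n≡k = begin
      length (primitiveWords n l) + binomQ l 2 l 4         ≡⟨ cong (λ t → length (primitiveWords n l) + binomQ l 2 t 4) 2n∸l≡l ⟨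
      length (primitiveWords n l) + binomQ l 2 (2 * n ∸ l) 4 ≡⟨ #primitiveWords+#halfPeriodic ⟩
      binomQ l 1 (n ∸ l) 2 + binomQ l 1 (2 * n ∸ l) 2 + count (primitiveAt? (3 * n)) (allVecs 2 l)
                                                           ≡⟨ cong₂ (λ a b → a + binomQ l 1 b 2 + count (primitiveAt? (3 * n)) (allVecs 2 l))
                                                                n∸l-term 2n∸l≡l ⟩
      1 + binomQ l 1 l 2 + count (primitiveAt? (3 * n)) (allVecs 2 l) ≡⟨ cong (1 + binomQ l 1 l 2 +_) #primitiveAt3n≡k ⟩
      1 + binomQ l 1 l 2 + k                               ≡⟨ x∙yz≈yx∙z (binomQ l 1 l 2) 1 k ⟨
      binomQ l 1 l 2 + (1 + k)                             ∎
      where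
      open ≡-Reasoning
      2n∸l≡l : 2 * n ∸ l ≡ l
      2n∸l≡l = trans (cong (λ t → 2 * t ∸ l) (sym l≡n)) (trans (cong (λ t → l + t ∸ l) (+-identityʳ l)) (m+n∸m≡n l l))
      n∸l-term : binomQ l 1 (n ∸ l) 2 ≡ 1
      n∸l-term = trans (cong (λ t → binomQ l 1 (t ∸ l) 2) (sym l≡n))
        (trans (cong (λ t → binomQ l 1 t 2) (n∸n≡0 l)) (binomQ-∣ l 1 0 2 (1∣ l) (divides 0 refl)))

  l*PO≡n*#primitiveWords : ∀ n l .{{_ : NonZero n}} .{{_ : NonZero l}} → 2 < n →
    l * PO n l ≡ n * length (primitiveWords n l)
  l*PO≡n*#primitiveWords n l 2<n = trans (l*PO≡#primitiveCircuits n l) (Encoding.#primitiveCircuits≡n*#primitiveWords 2<n)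

  PO≡#primitiveWords : ∀ n l .{{_ : NonZero n}} .{{_ : NonZero l}} → 2 < n → l ≡ n →
    PO n l ≡ length (primitiveWords n l)
  PO≡#primitiveWords n l 2<n l≡n =
    *-cancelˡ-≡ (PO n l) _ n (trans (cong (_* PO n l) (sym l≡n)) (l*PO≡n*#primitiveWords n l 2<n))

open import Algebra.Properties.CommutativeSemigroup using (xy∙z≈xz∙y)
open import Data.Integer using (+_; -_; _+_; _-_; _*_; _⊖_)
open import Data.Integer.Properties using (pos-+; pos-*; m-n≡m⊖n; ⊖-≥; +-commutativeSemigroup)
open import Data.List using (length)
open import Data.Nat using (ℕ; _<_; _≤_; _∸_; NonZero)
import Data.Nat as ℕ
open import Data.Nat.Divisibility using (_∣_)
open import Data.Nat.Properties using (<⇒≤; m≤n+m; m+n∸n≡m)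
open import Data.Product using (_×_; _,_)
open import Relation.Binary.PropositionalEquality using (_≡_; sym; cong; trans; subst; module ≡-Reasoning)
open import Relation.Nullary using (¬_)
open import Defs
open CirculantOrbits using (count; primitiveWords; l*PO≡n*#primitiveWords; PO≡#primitiveWords; module Classification)

+b-+c≡+a : ∀ a b c → a ℕ.+ c ≡ b → + b - + c ≡ + a
+b-+c≡+a a b c a+c≡b = begin
  + b - + c       ≡⟨ m-n≡m⊖n b c ⟩
  b ⊖ c           ≡⟨ ⊖-≥ (subst (c ℕ.≤_) a+c≡b (m≤n+m c a)) ⟩
  + (b ∸ c)       ≡⟨ cong (λ t → + (t ∸ c)) a+c≡b ⟨
  + (a ℕ.+ c ∸ c) ≡⟨ cong +_ (m+n∸n≡m a c) ⟩
  + a             ∎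
  where open ≡-Reasoning

+a≡+b++c-+d : ∀ a b c d → a ℕ.+ d ≡ b ℕ.+ c → + a ≡ + b + + c - + d
+a≡+b++c-+d a b c d eq = trans (sym (+b-+c≡+a a (b ℕ.+ c) d eq)) (cong (_- + d) (pos-+ b c))

proposition2 : (n l : ℕ) .{{_ : NonZero n}} .{{_ : NonZero l}} → 3 < n → l ≤ n →
    (l < n → + l * + PO n l
               ≡ + n * (+ binomQ l 1 (n ∸ l) 2 + + binomQ l 1 (2 Data.Nat.* n ∸ l) 2
                        - + binomQ l 2 (2 Data.Nat.* n ∸ l) 4))
  × (l ≡ n → 3 ∣ n → + PO n l ≡ + binomQ l 1 l 2 - + binomQ l 2 l 4 + + 1)
  × (l ≡ n → ¬ (3 ∣ n) → + PO n l ≡ + binomQ l 1 l 2 - + binomQ l 2 l 4 + + 2)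
proposition2 n l 3<n l≤n =
  l<n-case ,
  (λ l≡n 3∣n → l≡n-case l≡n (#primitiveAt3n-∣ l≡n 3∣n)) ,
  (λ l≡n 3∤n → l≡n-case l≡n (#primitiveAt3n-∤ l≡n 3∤n))
  where
  open Classification {n} {l} l≤n
  open ≡-Reasoning
  2<n : 2 < n
  2<n = <⇒≤ 3<n
  P : ℕ
  P = length (primitiveWords n l)
  A B C : ℕ
  A = binomQ l 1 (n ∸ l) 2
  B = binomQ l 1 (2 ℕ.* n ∸ l) 2
  C = binomQ l 2 (2 ℕ.* n ∸ l) 4
  l<n-case : l < n → + l * + PO n l ≡ + n * (+ A + + B - + C)
  l<n-case l<n = begin
    + l * + PO n l     ≡⟨ pos-* l (PO n l) ⟨
    + (l ℕ.* PO n l)   ≡⟨ cong +_ (l*PO≡n*#primitiveWords n l 2<n) ⟩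
    + (n ℕ.* P)        ≡⟨ pos-* n P ⟩
    + n * + P          ≡⟨ cong (+ n *_) (+a≡+b++c-+d P A B C (#primitiveWords-l<n l<n)) ⟩
    + n * (+ A + + B - + C) ∎
  l≡n-case : l ≡ n → ∀ {k} → count (primitiveAt? (3 ℕ.* n)) (allVecs 2 l) ≡ k →
    + PO n l ≡ + binomQ l 1 l 2 - + binomQ l 2 l 4 + + (1 ℕ.+ k)
  l≡n-case l≡n {k} #primitiveAt3n≡k = begin
    + PO n l                                          ≡⟨ cong +_ (PO≡#primitiveWords n l 2<n l≡n) ⟩
    + P                                               ≡⟨ +a≡+b++c-+d P (binomQ l 1 l 2) (1 ℕ.+ k) (binomQ l 2 l 4)
                                                           (#primitiveWords-l≡n l≡n #primitiveAt3n≡k) ⟩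
    + binomQ l 1 l 2 + + (1 ℕ.+ k) - + binomQ l 2 l 4 ≡⟨ xy∙z≈xz∙y +-commutativeSemigroup
                                                           (+ binomQ l 1 l 2) (+ (1 ℕ.+ k)) (- + binomQ l 2 l 4) ⟩
    + binomQ l 1 l 2 - + binomQ l 2 l 4 + + (1 ℕ.+ k) ∎
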